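{- Define integers $s_n(i,j)$ ($n\ge0$, $i,j\in\mathbb Z$) by $s_0(1,0)=1$, $s_0(i,j)=0$ for $(i,j)\ne(1,0)$, and $$\begin{aligned}s_{n+1}(i,j)&=i(i+1)s_n(i+1,j-2)+i(2j-1)s_n(i,j-1)+4i(3n+5-i-2j)s_n(i,j-2)+j^2s_n(i-1,j)\\&\quad+\big(4(j-1)(3n+4-i-2j)+6n+6-2i-2j\big)s_n(i-1,j-1)\\&\quad+4(3n+6-i-2j)(3n+5-i-2j)s_n(i-1,j-2).\end{aligned}$$ Then for $n\ge1$, $$S_n(x,y,z)=\sum_{i=1}^{n}z^{i}\sum_{j=1}^{\lfloor(3n+1-i)/2\rfloor}s_{n}(i,j)(xy)^{j}(x+y)^{3n+1-i-2j}.$$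
   Context: $M_n=\{\overline1,1,1,\overline2,2,2,\dots,\overline n,n,n\}$ with the total order $\overline1<1<\overline2<2<\cdots<\overline n<n$. A Jacobi-Stirling permutation of $M_n$ is a permutation $\pi_1\cdots\pi_{3n}$ of $M_n$ such that for each $i\in[n]$ all entries between the two occurrences of the unbarred $i$ are larger than $i$; $\mathrm{JSP}_n$ is the set of these. Set $\pi_0=\pi_{3n+1}=0$; for $0\le i\le 3n$, $i$ is an ascent, descent or plateau if $\pi_i<\pi_{i+1}$, $\pi_i>\pi_{i+1}$ or $\pi_i=\pi_{i+1}$, counted by $\mathrm{asc},\mathrm{des},\mathrm{plat}$. $S_n(x,y,z)=\sum_{\pi\in\mathrm{JSP}_n}x^{\mathrm{asc}(\pi)}y^{\mathrm{des}(\pi)}z^{\mathrm{plat}(\pi)}$. -}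

module Defs where

open import Data.Nat as ℕ using (ℕ; zero; suc; _∸_; ⌊_/2⌋)
open import Data.Integer as ℤ using (ℤ; +_; _+_; _-_; _*_; _^_)
open import Data.Bool using (Bool; true; false; _∧_; not; if_then_else_; T?)
open import Data.List using (List; []; _∷_; _++_; map; concatMap; filter; length; drop)
open import Relation.Nullary.Decidable using (⌊_⌋)
open import Relation.Binary.PropositionalEquality using (_≡_)

-- Letters of M_n are encoded by natural numbers preserving the total order
--   bar k  ↦ 2k - 1 ,   k (unbarred) ↦ 2k      (k ≥ 1)
-- so  bar1 < 1 < bar2 < 2 < ... corresponds to 1 < 2 < 3 < 4 < ...
-- and the boundary value π₀ = π_{3n+1} = 0 is encoded by 0 (smaller than all letters).
barred : ℕ → ℕ
barred k = 2 ℕ.* k ∸ 1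

unbarred : ℕ → ℕ
unbarred k = 2 ℕ.* k

allB : {A : Set} → (A → Bool) → List A → Bool
allB p [] = true
allB p (a ∷ l) = p a ∧ allB p l

takeWhileB : {A : Set} → (A → Bool) → List A → List A
takeWhileB p [] = []
takeWhileB p (a ∷ l) = if p a then a ∷ takeWhileB p l else []

dropWhileB : {A : Set} → (A → Bool) → List A → List A
dropWhileB p [] = []
dropWhileB p (a ∷ l) = if p a then dropWhileB p l else a ∷ l

oneTo : ℕ → List ℕ
oneTo zero = []
oneTo (suc m) = oneTo m ++ (suc m ∷ [])

words : ℕ → ℕ → List (List ℕ)
words m zero = [] ∷ []
words m (suc L) = concatMap (λ a → map (a ∷_) (words m L)) (oneTo m)

count : ℕ → List ℕ → ℕ
count a [] = 0
count a (b ∷ w) = if ⌊ a ℕ.≟ b ⌋ then suc (count a w) else count a w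

-- w is a permutation of the multiset M_n (w is assumed to be a word over {1..2n}
-- of length 3n): each bar k occurs once and each unbarred k occurs twice.
isPermM : ℕ → List ℕ → Bool
isPermM n w = ⌊ length w ℕ.≟ 3 ℕ.* n ⌋
  ∧ allB (λ k → ⌊ count (barred k) w ℕ.≟ 1 ⌋ ∧ ⌊ count (unbarred k) w ℕ.≟ 2 ⌋) (oneTo n)

between : ℕ → List ℕ → List ℕ
between a w = takeWhileB (λ b → not ⌊ b ℕ.≟ a ⌋) (drop 1 (dropWhileB (λ b → not ⌊ b ℕ.≟ a ⌋) w))

isJSCond : ℕ → List ℕ → Bool
isJSCond n w = allB (λ i → allB (λ b → ⌊ unbarred i ℕ.<? b ⌋) (between (unbarred i) w)) (oneTo n)

JSP : ℕ → List (List ℕ)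
JSP n = filter (λ w → T? (isPermM n w ∧ isJSCond n w)) (words (2 ℕ.* n) (3 ℕ.* n))

countAdj : (ℕ → ℕ → Bool) → List ℕ → ℕ
countAdj R (a ∷ b ∷ w) = (if R a b then 1 else 0) ℕ.+ countAdj R (b ∷ w)
countAdj R _ = 0

padded : List ℕ → List ℕ
padded w = 0 ∷ w ++ (0 ∷ [])

asc des plat : List ℕ → ℕ
asc w  = countAdj (λ a b → ⌊ a ℕ.<? b ⌋) (padded w)
des w  = countAdj (λ a b → ⌊ b ℕ.<? a ⌋) (padded w)
plat w = countAdj (λ a b → ⌊ a ℕ.≟ b ⌋) (padded w)

sumℤ : List ℤ → ℤ
sumℤ [] = + 0
sumℤ (a ∷ l) = a + sumℤ l

S : ℕ → ℤ → ℤ → ℤ → ℤ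
S n x y z = sumℤ (map (λ π → (x ^ asc π) * (y ^ des π) * (z ^ plat π)) (JSP n))

Σ1to : ℕ → (ℕ → ℤ) → ℤ
Σ1to m f = sumℤ (map f (oneTo m))

s : ℕ → ℤ → ℤ → ℤ
s zero i j = if ⌊ i ℤ.≟ + 1 ⌋ ∧ ⌊ j ℤ.≟ + 0 ⌋ then + 1 else + 0
s (suc n) i j =
    i * (i + + 1) * s n (i + + 1) (j - + 2)
  + i * (+ 2 * j - + 1) * s n i (j - + 1)
  + + 4 * i * (+ 3 * N + + 5 - i - + 2 * j) * s n i (j - + 2)
  + j * j * s n (i - + 1) j
  + (+ 4 * (j - + 1) * (+ 3 * N + + 4 - i - + 2 * j) + + 6 * N + + 6 - + 2 * i - + 2 * j) * s n (i - + 1) (j - + 1)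
  + + 4 * (+ 3 * N + + 6 - i - + 2 * j) * (+ 3 * N + + 5 - i - + 2 * j) * s n (i - + 1) (j - + 2)
  where N = + n

RHS : ℕ → ℤ → ℤ → ℤ → ℤ
RHS n x y z = Σ1to n (λ i → (z ^ i) *
  Σ1to ⌊ (3 ℕ.* n ℕ.+ 1 ∸ i) /2⌋ (λ j →
    s n (+ i) (+ j) * ((x * y) ^ j) * ((x + y) ^ (3 ℕ.* n ℕ.+ 1 ∸ i ∸ 2 ℕ.* j))))

-- Every word of JSP (n + 1) arises exactly once from a word of JSP n by inserting the barred letter n+1 into
-- one of its gaps and then the block (n+1)(n+1) into a gap of the result: both new letters exceed all old ones,
-- so the Jacobi–Stirling conditions of the old letters are unaffected and the new one holds. A largest
-- letter inserted into an ascent, a descent or a plateau changes (asc, des, plat) in a fixed way, so the sum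
-- over JSP (n + 1) of any function f of the statistics is the sum over JSP n of insertMax (insertMaxPair f).
-- In the basis zⁱ (xy)ʲ (x + y)ᵉ these two operators act through the derivation xy (∂ₓ + ∂ᵧ), and the
-- resulting recursion for the coefficients is exactly the one defining sₙ(i, j).

module Submission where

open import Defs
open import Data.Bool using (Bool; true; false; T; T?; not; _∧_; if_then_else_)
import Data.Bool.Properties as BoolP
open import Data.Empty using (⊥-elim)
open import Data.Integer as ℤ using (ℤ; +_; _+_; _-_; _*_; _^_)
import Data.Integer.Properties as ℤP
open import Data.Integer.Tactic.RingSolver using (solve-∀)
open import Algebra.Properties.CommutativeSemigroup ℤP.+-commutativeSemigroup
  using () renaming (interchange to +-interchange; x∙yz≈y∙xz to +-left-comm)
open import Data.List using (List; []; _∷_; _++_; map; concatMap; filter; length; drop)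
import Data.List.Properties as ListP
open import Data.List.Relation.Unary.All as All using (All; []; _∷_)
import Data.List.Relation.Unary.All.Properties as AllP
open import Data.List.Relation.Unary.Any using (here; there)
open import Data.List.Relation.Unary.Unique.Propositional using (Unique; []; _∷_)
import Data.List.Relation.Unary.Unique.Propositional.Properties as UniqueP
open import Data.List.Membership.Propositional using (_∈_; find; lose)
open import Data.List.Membership.Propositional.Properties
  using (∈-++⁻; ∈-++⁺ˡ; ∈-++⁺ʳ; ∈-map⁺; ∈-map⁻; ∈-concatMap⁺; ∈-concatMap⁻; ∈-filter⁺; ∈-filter⁻)
open import Data.List.Membership.Propositional.Properties.WithK using (unique∧set⇒bag)
open import Data.List.Relation.Binary.BagAndSetEquality using (∼bag⇒↭)
open import Data.List.Relation.Binary.Permutation.Propositional as ↭ using (_↭_)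
open import Data.Nat as ℕ using (ℕ; zero; suc; _∸_; _<_; _≤_; _≥_; z≤n; s≤s; ⌊_/2⌋)
import Data.Nat.Properties as ℕP
import Data.Nat.Tactic.RingSolver as ℕS
open import Data.Product using (_×_; _,_; ∃; ∃₂; proj₁; proj₂; uncurry)
open import Data.Sum using (_⊎_; inj₁; inj₂)
open import Relation.Nullary using (¬_; ¬?; Dec; yes; no)
import Relation.Unary as U
open import Relation.Binary using (tri<; tri≈; tri>)
open import Relation.Nullary.Decidable using (⌊_⌋; isYes≗does; dec-true; dec-false; does-⇔; toWitness)
open import Function.Base using (_∘_; _$_)
open import Function.Bundles using (_⇔_; mk⇔; Equivalence)
open import Function.Construct.Symmetry using (⇔-sym)
open import Function.Construct.Identity using (⇔-id)
open import Relation.Binary.PropositionalEquality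

private
  variable
    X Y : Set

∑ : (X → ℤ) → List X → ℤ
∑ f xs = sumℤ (map f xs)

∑-++ : (f : X → ℤ) (xs ys : List X) → ∑ f (xs ++ ys) ≡ ∑ f xs + ∑ f ys
∑-++ f []       ys = sym (ℤP.+-identityˡ _)
∑-++ f (x ∷ xs) ys = trans (cong (_+_ (f x)) (∑-++ f xs ys)) (sym (ℤP.+-assoc (f x) _ _))

∑-cong : {f g : X → ℤ} (xs : List X) → All (λ x → f x ≡ g x) xs → ∑ f xs ≡ ∑ g xs
∑-cong []       []         = refl
∑-cong (x ∷ xs) (eq ∷ eqs) = cong₂ _+_ eq (∑-cong xs eqs)

∑-congᵖ : {f g : X → ℤ} → (∀ x → f x ≡ g x) → (xs : List X) → ∑ f xs ≡ ∑ g xs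
∑-congᵖ eq xs = ∑-cong xs (All.universal eq xs)

∑-zero : (xs : List X) → ∑ (λ _ → + 0) xs ≡ + 0
∑-zero []       = refl
∑-zero (x ∷ xs) = trans (ℤP.+-identityˡ _) (∑-zero xs)

∑-+ : (f g : X → ℤ) (xs : List X) → ∑ (λ x → f x + g x) xs ≡ ∑ f xs + ∑ g xs
∑-+ f g []       = refl
∑-+ f g (x ∷ xs) rewrite ∑-+ f g xs = +-interchange (f x) (g x) (∑ f xs) (∑ g xs)

∑-*ˡ : (k : ℤ) (f : X → ℤ) (xs : List X) → ∑ (λ x → k * f x) xs ≡ k * ∑ f xs
∑-*ˡ k f []       = sym (ℤP.*-zeroʳ k)
∑-*ˡ k f (x ∷ xs) rewrite ∑-*ˡ k f xs = sym (ℤP.*-distribˡ-+ k (f x) (∑ f xs))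

∑-*ʳ : (k : ℤ) (f : X → ℤ) (xs : List X) → ∑ (λ x → f x * k) xs ≡ ∑ f xs * k
∑-*ʳ k f []       = sym (ℤP.*-zeroˡ k)
∑-*ʳ k f (x ∷ xs) rewrite ∑-*ʳ k f xs = sym (ℤP.*-distribʳ-+ k (f x) (∑ f xs))

∑-map : (f : Y → ℤ) (h : X → Y) (xs : List X) → ∑ f (map h xs) ≡ ∑ (λ x → f (h x)) xs
∑-map f h []       = refl
∑-map f h (x ∷ xs) = cong (_+_ (f (h x))) (∑-map f h xs)

∑-concatMap : (f : Y → ℤ) (g : X → List Y) (xs : List X) →
              ∑ f (concatMap g xs) ≡ ∑ (λ x → ∑ f (g x)) xs
∑-concatMap f g []       = refl
∑-concatMap f g (x ∷ xs) = trans (∑-++ f (g x) (concatMap g xs)) (cong (_+_ (∑ f (g x))) (∑-concatMap f g xs))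

∑-comm : (F : X → Y → ℤ) (xs : List X) (ys : List Y) →
         ∑ (λ x → ∑ (F x) ys) xs ≡ ∑ (λ y → ∑ (λ x → F x y) xs) ys
∑-comm F []       ys = sym (∑-zero ys)
∑-comm F (x ∷ xs) ys =
  trans (cong (_+_ (∑ (F x) ys)) (∑-comm F xs ys)) (sym (∑-+ (F x) (λ y → ∑ (λ x → F x y) xs) ys))

∑-↭ : (f : X → ℤ) {xs ys : List X} → xs ↭ ys → ∑ f xs ≡ ∑ f ys
∑-↭ f ↭.refl         = refl
∑-↭ f (↭.prep x p)   = cong (_+_ (f x)) (∑-↭ f p)
∑-↭ f (↭.swap x y p) rewrite ∑-↭ f p = +-left-comm (f x) (f y) _
∑-↭ f (↭.trans p q)  = trans (∑-↭ f p) (∑-↭ f q)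

∑-same-elements : (f : X → ℤ) {xs ys : List X} → Unique xs → Unique ys →
                  (∀ {x} → x ∈ xs → x ∈ ys) → (∀ {x} → x ∈ ys → x ∈ xs) → ∑ f xs ≡ ∑ f ys
∑-same-elements f xs! ys! xs⊆ys ys⊆xs = ∑-↭ f (∼bag⇒↭ (unique∧set⇒bag xs! ys! (mk⇔ xs⊆ys ys⊆xs)))

⌊⌋-true : {P : Set} (p? : Dec P) → P → ⌊ p? ⌋ ≡ true
⌊⌋-true p? p = trans (isYes≗does p?) (dec-true p? p)

⌊⌋-false : {P : Set} (p? : Dec P) → ¬ P → ⌊ p? ⌋ ≡ false
⌊⌋-false p? ¬p = trans (isYes≗does p?) (dec-false p? ¬p)

⌊⌋-⇔ : {P Q : Set} → P ⇔ Q → (p? : Dec P) (q? : Dec Q) → ⌊ p? ⌋ ≡ ⌊ q? ⌋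
⌊⌋-⇔ P⇔Q p? q? = trans (isYes≗does p?) (trans (does-⇔ P⇔Q p? q?) (sym (isYes≗does q?)))

T-∧⁻ : ∀ x y → T (x ∧ y) → T x × T y
T-∧⁻ x y = Equivalence.to (BoolP.T-∧ {x} {y})

All-concatMap : {P : X → Set} {Q : Y → Set} (f : X → List Y) → (∀ {x} → P x → All Q (f x)) →
                (xs : List X) → All P xs → All Q (concatMap f xs)
All-concatMap f h xs ps = AllP.concat⁺ (AllP.map⁺ (All.map h ps))

∈-concatMap⁻′ : (g : X → List Y) {xs : List X} {y : Y} → y ∈ concatMap g xs → ∃ λ x → x ∈ xs × y ∈ g x
∈-concatMap⁻′ g p = find (∈-concatMap⁻ g p)

∈-concatMap⁺′ : (g : X → List Y) {xs : List X} {x : X} {y : Y} → x ∈ xs → y ∈ g x → y ∈ concatMap g xs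
∈-concatMap⁺′ g x∈xs y∈gx = ∈-concatMap⁺ g (lose x∈xs y∈gx)

Unique-concatMap : (g : X → List Y) (tag : Y → X) {xs : List X} → Unique xs → (∀ {x} → x ∈ xs → Unique (g x)) →
                   (∀ {x y} → x ∈ xs → y ∈ g x → tag y ≡ x) → Unique (concatMap g xs)
Unique-concatMap g tag {[]}     _          _  _   = []
Unique-concatMap g tag {x ∷ xs} (x∉ ∷ xs!) g! tag≡ =
  UniqueP.++⁺ (g! (here refl)) (Unique-concatMap g tag xs! (g! ∘ there) (tag≡ ∘ there)) disjoint
  where
  disjoint : ∀ {y} → ¬ (y ∈ g x × y ∈ concatMap g xs)
  disjoint (y∈gx , y∈rest) with ∈-concatMap⁻′ g y∈rest
  ... | x′ , x′∈xs , y∈gx′ = All.lookup x∉ x′∈xs (trans (sym (tag≡ (here refl) y∈gx)) (tag≡ (there x′∈xs) y∈gx′))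

∈-oneTo⁻ : ∀ {k} m → k ∈ oneTo m → 1 ≤ k × k ≤ m
∈-oneTo⁻ (suc m) p with ∈-++⁻ (oneTo m) p
... | inj₁ q        = proj₁ (∈-oneTo⁻ m q) , ℕP.m≤n⇒m≤1+n (proj₂ (∈-oneTo⁻ m q))
... | inj₂ (here refl) = s≤s z≤n , ℕP.≤-refl

∈-oneTo⁺ : ∀ {k} m → 1 ≤ k → k ≤ m → k ∈ oneTo m
∈-oneTo⁺ zero    (s≤s _) ()
∈-oneTo⁺ {k} (suc m) 1≤k k≤1+m with k ℕ.≟ suc m
... | yes refl = ∈-++⁺ʳ (oneTo m) (here refl)
... | no  k≢   = ∈-++⁺ˡ (∈-oneTo⁺ m 1≤k (ℕP.≤-pred (ℕP.≤∧≢⇒< k≤1+m k≢)))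

Unique-oneTo : ∀ m → Unique (oneTo m)
Unique-oneTo zero    = []
Unique-oneTo (suc m) = UniqueP.++⁺ (Unique-oneTo m) ([] ∷ []) λ { (p , here refl) → ℕP.<-irrefl refl (proj₂ (∈-oneTo⁻ m p)) }

∑-oneTo-vanishing : ∀ m (F : ℕ → ℤ) → (∀ k → k ≤ m → F k ≡ + 0) → ∑ F (oneTo m) ≡ + 0
∑-oneTo-vanishing zero    F _ = refl
∑-oneTo-vanishing (suc m) F h = trans (∑-++ F (oneTo m) (suc m ∷ []))
  (cong₂ (λ u v → u + (v + + 0)) (∑-oneTo-vanishing m F (λ k k≤m → h k (ℕP.m≤n⇒m≤1+n k≤m))) (h (suc m) ℕP.≤-refl))

∑-oneTo-single : ∀ m a (F : ℕ → ℤ) → 1 ≤ a → a ≤ m → (∀ k → k ≢ a → F k ≡ + 0) → ∑ F (oneTo m) ≡ F a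
∑-oneTo-single zero    zero    F () _  _
∑-oneTo-single zero    (suc a) F _  () _
∑-oneTo-single (suc m) a F 1≤a a≤1+m h with a ℕ.≟ suc m
... | yes refl = trans (∑-++ F (oneTo m) (suc m ∷ []))
  (trans (cong (λ u → u + (F (suc m) + + 0)) (∑-oneTo-vanishing m F (λ k k≤m → h k λ { refl → ℕP.<-irrefl refl k≤m })))
         (trans (ℤP.+-identityˡ _) (ℤP.+-identityʳ _)))
... | no a≢1+m = trans (∑-++ F (oneTo m) (suc m ∷ []))
  (trans (cong₂ (λ u v → u + (v + + 0))
                (∑-oneTo-single m a F 1≤a (ℕP.≤-pred (ℕP.≤∧≢⇒< a≤1+m a≢1+m)) h) (h (suc m) (≢-sym a≢1+m)))
         (ℤP.+-identityʳ (F a)))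

count-++ : ∀ a u v → count a (u ++ v) ≡ count a u ℕ.+ count a v
count-++ a []      v = refl
count-++ a (c ∷ u) v with ⌊ a ℕ.≟ c ⌋
... | true  = cong suc (count-++ a u v)
... | false = count-++ a u v

count-≢ : ∀ {a c} u → a ≢ c → count a (c ∷ u) ≡ count a u
count-≢ {a} {c} u a≢c rewrite ⌊⌋-false (a ℕ.≟ c) a≢c = refl

count-≡ : ∀ a u → count a (a ∷ u) ≡ suc (count a u)
count-≡ a u rewrite ⌊⌋-true (a ℕ.≟ a) refl = refl

count≡0⇔∉ : ∀ a u → count a u ≡ 0 ⇔ All (a ≢_) u
count≡0⇔∉ a u = mk⇔ (to u) (from u)
  where
  to : ∀ u → count a u ≡ 0 → All (a ≢_) u
  to []      _ = []
  to (c ∷ u) h with a ℕ.≟ c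
  ... | yes _   = ⊥-elim (ℕP.1+n≢0 h)
  ... | no  a≢c = a≢c ∷ to u h
  from : ∀ u → All (a ≢_) u → count a u ≡ 0
  from []      []          = refl
  from (c ∷ u) (a≢c ∷ a∉u) = trans (count-≢ u a≢c) (from u a∉u)

split-first : ∀ a w k → count a w ≡ suc k → ∃₂ λ u r → w ≡ u ++ a ∷ r × All (a ≢_) u × count a r ≡ k
split-first a (c ∷ w) k h with a ℕ.≟ c
... | yes refl = [] , w , refl , [] , ℕP.suc-injective h
... | no  a≢c with split-first a w k h
... | u , r , refl , a∉u , r-count = c ∷ u , r , refl , a≢c ∷ a∉u , r-count

_≢ᵇ_ : ℕ → ℕ → Bool
b ≢ᵇ a = not ⌊ b ℕ.≟ a ⌋

between-first : ∀ a u r → All (a ≢_) u → between a (u ++ a ∷ r) ≡ takeWhileB (_≢ᵇ a) r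
between-first a u r a∉u = cong (λ l → takeWhileB (_≢ᵇ a) (drop 1 l)) (skip u a∉u)
  where
  skip : ∀ u → All (a ≢_) u → dropWhileB (_≢ᵇ a) (u ++ a ∷ r) ≡ a ∷ r
  skip []      []          rewrite ⌊⌋-true (a ℕ.≟ a) refl = refl
  skip (c ∷ u) (a≢c ∷ a∉u) rewrite ⌊⌋-false (c ℕ.≟ a) (≢-sym a≢c) = skip u a∉u

takeWhile-≢ : ∀ {a c} r → c ≢ a → takeWhileB (_≢ᵇ a) (c ∷ r) ≡ c ∷ takeWhileB (_≢ᵇ a) r
takeWhile-≢ {a} {c} r c≢a rewrite ⌊⌋-false (c ℕ.≟ a) c≢a = refl

module _ {P : ℕ → Set} (P? : U.Decidable P) {a : ℕ} (Pa : P a) where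

  dropWhile-filter : ∀ w → dropWhileB (_≢ᵇ a) (filter P? w) ≡ filter P? (dropWhileB (_≢ᵇ a) w)
  dropWhile-filter []      = refl
  dropWhile-filter (c ∷ w) with c ℕ.≟ a
  ... | yes refl rewrite ListP.filter-accept P? {c} {w} Pa | ⌊⌋-true (c ℕ.≟ c) refl = refl
  ... | no  c≢a with P? c
  ...   | yes _ rewrite ⌊⌋-false (c ℕ.≟ a) c≢a = dropWhile-filter w
  ...   | no  _ = dropWhile-filter w

  takeWhile-filter : ∀ w → takeWhileB (_≢ᵇ a) (filter P? w) ≡ filter P? (takeWhileB (_≢ᵇ a) w)
  takeWhile-filter []      = refl
  takeWhile-filter (c ∷ w) with c ℕ.≟ a
  ... | yes refl rewrite ListP.filter-accept P? {c} {w} Pa | ⌊⌋-true (c ℕ.≟ c) refl = refl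
  ... | no  c≢a with P? c
  ...   | yes _ rewrite ⌊⌋-false (c ℕ.≟ a) c≢a = cong (c ∷_) (takeWhile-filter w)
  ...   | no  _ = takeWhile-filter w

  between-filter : ∀ w → between a (filter P? w) ≡ filter P? (between a w)
  between-filter w =
    trans (cong (λ l → takeWhileB (_≢ᵇ a) (drop 1 l)) (dropWhile-filter w))
          (trans (cong (takeWhileB (_≢ᵇ a)) (drop-head (dropWhileB (_≢ᵇ a) w) (dropWhile-shape w)))
                 (takeWhile-filter (drop 1 (dropWhileB (_≢ᵇ a) w))))
    where
    dropWhile-shape : ∀ w → dropWhileB (_≢ᵇ a) w ≡ [] ⊎ ∃ λ r → dropWhileB (_≢ᵇ a) w ≡ a ∷ r
    dropWhile-shape []      = inj₁ refl
    dropWhile-shape (c ∷ w) with c ℕ.≟ a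
    ... | yes refl = inj₂ (w , refl)
    ... | no  _    = dropWhile-shape w
    drop-head : ∀ l → (l ≡ [] ⊎ ∃ λ r → l ≡ a ∷ r) → drop 1 (filter P? l) ≡ filter P? (drop 1 l)
    drop-head .[]      (inj₁ refl)       = refl
    drop-head .(a ∷ r) (inj₂ (r , refl)) = cong (drop 1) (ListP.filter-accept P? Pa)

allB-filter : ∀ {P : ℕ → Set} (P? : U.Decidable P) (p : ℕ → Bool) xs → (∀ c → ¬ P c → p c ≡ true) →
              allB p (filter P? xs) ≡ allB p xs
allB-filter P? p []       h = refl
allB-filter P? p (c ∷ xs) h with P? c
... | yes _  = cong (p c ∧_) (allB-filter P? p xs h)
... | no ¬Pc rewrite h c ¬Pc = allB-filter P? p xs h

allB-++ : (p : X → Bool) (xs ys : List X) → allB p (xs ++ ys) ≡ allB p xs ∧ allB p ys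
allB-++ p []       ys = refl
allB-++ p (x ∷ xs) ys rewrite allB-++ p xs ys = sym (BoolP.∧-assoc (p x) (allB p xs) (allB p ys))

allB-oneTo-cong : ∀ m {p q : ℕ → Bool} → (∀ k → k ≤ m → p k ≡ q k) → allB p (oneTo m) ≡ allB q (oneTo m)
allB-oneTo-cong m {p} {q} eq = go (oneTo m) (All.tabulate (λ k∈ → eq _ (proj₂ (∈-oneTo⁻ m k∈))))
  where
  go : ∀ xs → All (λ k → p k ≡ q k) xs → allB p xs ≡ allB q xs
  go []       []         = refl
  go (x ∷ xs) (px ∷ pxs) = cong₂ _∧_ px (go xs pxs)

allB-oneTo-suc : ∀ {p : ℕ → Bool} m → allB p (oneTo (suc m)) ≡ allB p (oneTo m) ∧ p (suc m)
allB-oneTo-suc {p} m = trans (allB-++ p (oneTo m) (suc m ∷ [])) (cong (allB p (oneTo m) ∧_) (BoolP.∧-identityʳ (p (suc m))))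

-- Binomial sums

-- binomialSum α β e g = Σₖ (e choose k) · g (α + k) (β + e − k); for g a d = xᵃ yᵈ w this is xᵅ yᵝ (x + y)ᵉ w.
binomialSum : ℕ → ℕ → ℕ → (ℕ → ℕ → ℤ) → ℤ
binomialSum α β zero    g = g α β
binomialSum α β (suc e) g = binomialSum (suc α) β e g + binomialSum α (suc β) e g

module _ where
  private B = binomialSum

  binomialSum-+ : ∀ α β e (g h : ℕ → ℕ → ℤ) → B α β e (λ a d → g a d + h a d) ≡ B α β e g + B α β e h
  binomialSum-+ α β zero    g h = refl
  binomialSum-+ α β (suc e) g h
    rewrite binomialSum-+ (suc α) β e g h | binomialSum-+ α (suc β) e g h =
    +-interchange (B (suc α) β e g) (B (suc α) β e h) (B α (suc β) e g) (B α (suc β) e h)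

  binomialSum-*ˡ : ∀ α β e (k : ℤ) (g : ℕ → ℕ → ℤ) → B α β e (λ a d → k * g a d) ≡ k * B α β e g
  binomialSum-*ˡ α β zero    k g = refl
  binomialSum-*ˡ α β (suc e) k g rewrite binomialSum-*ˡ (suc α) β e k g | binomialSum-*ˡ α (suc β) e k g =
    sym (ℤP.*-distribˡ-+ k _ _)

  binomialSum-suc : ∀ α β e (g : ℕ → ℕ → ℤ) → B α β e (λ a d → g (suc a) (suc d)) ≡ B (suc α) (suc β) e g
  binomialSum-suc α β zero    g = refl
  binomialSum-suc α β (suc e) g = cong₂ _+_ (binomialSum-suc (suc α) β e g) (binomialSum-suc α (suc β) e g)

  -- The Leibniz rule for xy (∂ₓ + ∂ᵧ) applied to xᵅ yᵝ (x + y)ᵉ.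
  binomialSum-derivation : ∀ e α β (G : ℕ → ℕ → ℤ) →
    B α β e (λ a d → + a * G a (suc d)) + B α β e (λ a d → + d * G (suc a) d)
    ≡ + α * B α (suc β) e G + + β * B (suc α) β e G + + 2 * + e * B (suc α) (suc β) (e ∸ 1) G
  binomialSum-derivation zero α β G = sym (ℤP.+-identityʳ _)
  binomialSum-derivation (suc e) α β G = begin
      (B (suc α) β e aG + B α (suc β) e aG) + (B (suc α) β e dG + B α (suc β) e dG)
    ≡⟨ +-interchange (B (suc α) β e aG) _ _ _ ⟩
      (B (suc α) β e aG + B (suc α) β e dG) + (B α (suc β) e aG + B α (suc β) e dG)
    ≡⟨ cong₂ _+_ (binomialSum-derivation e (suc α) β G) (binomialSum-derivation e α (suc β) G) ⟩
      (+ suc α * X₁ + + β * X₂ + + 2 * + e * X₃) + (+ α * X₄ + + suc β * X₁ + + 2 * + e * X₅)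
    ≡⟨ cong₂ (λ a b → (a * X₁ + + β * X₂ + + 2 * + e * X₃) + (+ α * X₄ + b * X₁ + + 2 * + e * X₅))
             (ℤP.pos-+ 1 α) (ℤP.pos-+ 1 β) ⟩
      ((+ 1 + + α) * X₁ + + β * X₂ + + 2 * + e * X₃) + (+ α * X₄ + (+ 1 + + β) * X₁ + + 2 * + e * X₅)
    ≡⟨ regroup (+ α) (+ β) (+ e) X₁ X₂ X₃ X₄ X₅ ⟩
      + α * (X₁ + X₄) + + β * (X₂ + X₁) + + 2 * X₁ + + 2 * (+ e * X₃ + + e * X₅)
    ≡⟨ cong (λ t → + α * (X₁ + X₄) + + β * (X₂ + X₁) + + 2 * X₁ + + 2 * t) (pascal e) ⟩
      + α * (X₁ + X₄) + + β * (X₂ + X₁) + + 2 * X₁ + + 2 * (+ e * X₁)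
    ≡⟨ collect (+ α * (X₁ + X₄) + + β * (X₂ + X₁)) (+ e) X₁ ⟩
      + α * (X₁ + X₄) + + β * (X₂ + X₁) + + 2 * (+ 1 + + e) * X₁
    ≡⟨ cong (λ t → + α * (X₁ + X₄) + + β * (X₂ + X₁) + + 2 * t * X₁) (sym (ℤP.pos-+ 1 e)) ⟩
      + α * (X₁ + X₄) + + β * (X₂ + X₁) + + 2 * + suc e * X₁
    ∎
    where
    open ≡-Reasoning
    aG dG : ℕ → ℕ → ℤ
    aG a d = + a * G a (suc d)
    dG a d = + d * G (suc a) d
    X₁ = B (suc α) (suc β) e G
    X₂ = B (suc (suc α)) β e G
    X₃ = B (suc (suc α)) (suc β) (e ∸ 1) G
    X₄ = B α (suc (suc β)) e G
    X₅ = B (suc α) (suc (suc β)) (e ∸ 1) G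
    pascal : ∀ e → + e * B (suc (suc α)) (suc β) (e ∸ 1) G + + e * B (suc α) (suc (suc β)) (e ∸ 1) G
                   ≡ + e * B (suc α) (suc β) e G
    pascal zero    = refl
    pascal (suc e) = sym (ℤP.*-distribˡ-+ (+ suc e) (B (suc (suc α)) (suc β) e G) (B (suc α) (suc (suc β)) e G))
    regroup : ∀ a b e x₁ x₂ x₃ x₄ x₅ →
      ((+ 1 + a) * x₁ + b * x₂ + + 2 * e * x₃) + (a * x₄ + (+ 1 + b) * x₁ + + 2 * e * x₅)
      ≡ a * (x₁ + x₄) + b * (x₂ + x₁) + + 2 * x₁ + + 2 * (e * x₃ + e * x₅)
    regroup = solve-∀
    collect : ∀ p e x → p + + 2 * x + + 2 * (e * x) ≡ p + + 2 * (+ 1 + e) * x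
    collect = solve-∀

  binomialSum-insert : ∀ j e (G H : ℕ → ℕ → ℤ) (k : ℤ) →
    B j j e (λ a d → + a * G a (suc d) + + d * G (suc a) d + k * H (suc a) (suc d))
    ≡ + j * B j j (suc e) G + + 2 * + e * B (suc j) (suc j) (e ∸ 1) G + k * B (suc j) (suc j) e H
  binomialSum-insert j e G H k = begin
      B j j e (λ a d → aG a d + dG a d + k * H (suc a) (suc d))
    ≡⟨ binomialSum-+ j j e (λ a d → aG a d + dG a d) (λ a d → k * H (suc a) (suc d)) ⟩
      B j j e (λ a d → aG a d + dG a d) + B j j e (λ a d → k * H (suc a) (suc d))
    ≡⟨ cong₂ _+_ (binomialSum-+ j j e aG dG)
                 (trans (binomialSum-*ˡ j j e k (λ a d → H (suc a) (suc d))) (cong (k *_) (binomialSum-suc j j e H))) ⟩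
      (B j j e aG + B j j e dG) + k * B (suc j) (suc j) e H
    ≡⟨ cong (_+ k * B (suc j) (suc j) e H) (binomialSum-derivation e j j G) ⟩
      + j * B j (suc j) e G + + j * B (suc j) j e G + + 2 * + e * B (suc j) (suc j) (e ∸ 1) G + k * B (suc j) (suc j) e H
    ≡⟨ factor (+ j) (B j (suc j) e G) (B (suc j) j e G) _ _ ⟩
      + j * (B (suc j) j e G + B j (suc j) e G) + + 2 * + e * B (suc j) (suc j) (e ∸ 1) G + k * B (suc j) (suc j) e H
    ∎
    where
    open ≡-Reasoning
    aG dG : ℕ → ℕ → ℤ
    aG a d = + a * G a (suc d)
    dG a d = + d * G (suc a) d
    factor : ∀ a x y z w → a * x + a * y + z + w ≡ a * (y + x) + z + w
    factor = solve-∀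

-- Weights of words, as functions of (asc, des, plat)

Weight : Set
Weight = ℕ → ℕ → ℕ → ℤ

-- Inserting a new largest letter into an ascent, a descent or a plateau changes (asc, des, plat)
-- by (0, 1, 0), (1, 0, 0) or (1, 1, −1); a doubled largest letter also adds a plateau.
insertMax insertMaxPair : Weight → Weight
insertMax     f a d p = + a * f a (suc d) p       + + d * f (suc a) d p       + + p * f (suc a) (suc d) (p ∸ 1)
insertMaxPair f a d p = + a * f a (suc d) (suc p) + + d * f (suc a) d (suc p) + + p * f (suc a) (suc d) p

-- The weight f, extended linearly from monomials xᵃ yᵈ zᵖ to polynomials, evaluated at zⁱ (xy)ʲ (x + y)ᵉ.
evalBasis : ℕ → ℕ → ℕ → Weight → ℤ
evalBasis i j e f = binomialSum j j e (λ a d → f a d i)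

-- term c i j e stands for c · zⁱ (xy)ʲ (x + y)ᵉ.
data Term : Set where
  term : ℤ → ℕ → ℕ → ℕ → Term

evalTerm : Weight → Term → ℤ
evalTerm f (term c i j e) = c * evalBasis i j e f

evalTerms : Weight → List Term → ℤ
evalTerms f = ∑ (evalTerm f)

-- The truncated indices e ∸ 1 and i ∸ 1 only truncate in terms whose coefficient is 0.
insertMaxTerms insertMaxPairTerms : Term → List Term
insertMaxTerms (term c i j e) =
  term (c * + j) i j (suc e) ∷ term (c * (+ 2 * + e)) i (suc j) (e ∸ 1) ∷ term (c * + i) (i ∸ 1) (suc j) e ∷ []
insertMaxPairTerms (term c i j e) =
  term (c * + j) (suc i) j (suc e) ∷ term (c * (+ 2 * + e)) (suc i) (suc j) (e ∸ 1) ∷ term (c * + i) i (suc j) e ∷ []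

private
  distribute : ∀ c j e i x y z → c * (j * x + + 2 * e * y + i * z) ≡ c * j * x + (c * (+ 2 * e) * y + (c * i * z + + 0))
  distribute = solve-∀

evalTerm-insertMax : ∀ f t → evalTerm (insertMax f) t ≡ evalTerms f (insertMaxTerms t)
evalTerm-insertMax f (term c i j e)
  rewrite binomialSum-insert j e (λ a d → f a d i) (λ a d → f a d (i ∸ 1)) (+ i) =
  distribute c (+ j) (+ e) (+ i) (evalBasis i j (suc e) f) (evalBasis i (suc j) (e ∸ 1) f) (evalBasis (i ∸ 1) (suc j) e f)

evalTerm-insertMaxPair : ∀ f t → evalTerm (insertMaxPair f) t ≡ evalTerms f (insertMaxPairTerms t)
evalTerm-insertMaxPair f (term c i j e)
  rewrite binomialSum-insert j e (λ a d → f a d (suc i)) (λ a d → f a d i) (+ i) =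
  distribute c (+ j) (+ e) (+ i) (evalBasis (suc i) j (suc e) f) (evalBasis (suc i) (suc j) (e ∸ 1) f) (evalBasis i (suc j) e f)

evalTerms-concatMap : ∀ {g f} (φ : Term → List Term) → (∀ t → evalTerm g t ≡ evalTerms f (φ t)) →
                      ∀ ts → evalTerms g ts ≡ evalTerms f (concatMap φ ts)
evalTerms-concatMap {f = f} φ eq ts = trans (∑-congᵖ eq ts) (sym (∑-concatMap (evalTerm f) φ ts))

expansion : ℕ → List Term
expansion zero    = term (+ 1) 1 0 0 ∷ []
expansion (suc n) = concatMap insertMaxPairTerms (concatMap insertMaxTerms (expansion n))

evalTerms-expansion-suc : ∀ f n → evalTerms (insertMax (insertMaxPair f)) (expansion n) ≡ evalTerms f (expansion (suc n))
evalTerms-expansion-suc f n =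
  trans (evalTerms-concatMap insertMaxTerms (evalTerm-insertMax (insertMaxPair f)) (expansion n))
        (evalTerms-concatMap insertMaxPairTerms (evalTerm-insertMaxPair f) (concatMap insertMaxTerms (expansion n)))

-- Coefficients of the expansion

indicator : ℕ → ℕ → ℤ → ℤ → ℤ
indicator a b I J = if ⌊ + a ℤ.≟ I ⌋ ∧ ⌊ + b ℤ.≟ J ⌋ then + 1 else + 0

coeffAt : ℤ → ℤ → Term → ℤ
coeffAt I J (term c i j e) = c * indicator i j I J

coefficient : ℕ → ℤ → ℤ → ℤ
coefficient n I J = ∑ (coeffAt I J) (expansion n)

*-indicator : ∀ {u v} a b I J → (+ a ≡ I → + b ≡ J → u ≡ v) → u * indicator a b I J ≡ v * indicator a b I J
*-indicator {u} {v} a b I J eq with + a ℤ.≟ I | + b ℤ.≟ J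
... | yes p | yes q = cong (_* + 1) (eq p q)
... | yes _ | no  _ = trans (ℤP.*-zeroʳ u) (sym (ℤP.*-zeroʳ v))
... | no  _ | _     = trans (ℤP.*-zeroʳ u) (sym (ℤP.*-zeroʳ v))

indicator-cong : ∀ {a b I J a′ b′ I′ J′} → (+ a ≡ I) ⇔ (+ a′ ≡ I′) → (+ b ≡ J) ⇔ (+ b′ ≡ J′) →
                 indicator a b I J ≡ indicator a′ b′ I′ J′
indicator-cong {a} {b} {I} {J} {a′} {b′} {I′} {J′} p q =
  cong₂ (λ u v → if u ∧ v then + 1 else + 0)
        (⌊⌋-⇔ p (+ a ℤ.≟ I) (+ a′ ℤ.≟ I′)) (⌊⌋-⇔ q (+ b ℤ.≟ J) (+ b′ ℤ.≟ J′))

+-suc-⇔ : ∀ a I → (+ suc a ≡ I + + 1) ⇔ (+ a ≡ I)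
+-suc-⇔ a I = mk⇔
  (λ eq → trans (sym (cancelˡ (+ a))) (trans (cong (_- + 1) (trans (sym (ℤP.pos-+ 1 a)) eq)) (cancelʳ I)))
  (λ eq → trans (ℤP.pos-+ 1 a) (trans (ℤP.+-comm (+ 1) (+ a)) (cong (_+ + 1) eq)))
  where
  cancelˡ : ∀ x → + 1 + x - + 1 ≡ x
  cancelˡ = solve-∀
  cancelʳ : ∀ x → x + + 1 - + 1 ≡ x
  cancelʳ = solve-∀

indicator-≢ˡ : ∀ a b k J → k ≢ a → indicator a b (+ k) J ≡ + 0
indicator-≢ˡ a b k J k≢a rewrite ⌊⌋-false (+ a ℤ.≟ + k) (λ eq → k≢a (sym (ℤP.+-injective eq))) = refl

indicator-≢ʳ : ∀ a b I l → l ≢ b → indicator a b I (+ l) ≡ + 0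
indicator-≢ʳ a b I l l≢b rewrite ⌊⌋-false (+ b ℤ.≟ + l) (λ eq → l≢b (sym (ℤP.+-injective eq))) with ⌊ + a ℤ.≟ I ⌋
... | true  = refl
... | false = refl

indicator-diag : ∀ a b → indicator a b (+ a) (+ b) ≡ + 1
indicator-diag a b rewrite ⌊⌋-true (+ a ℤ.≟ + a) refl | ⌊⌋-true (+ b ℤ.≟ + b) refl = refl

+-shift-⇔ : ∀ k a I → (+ (k ℕ.+ a) ≡ I) ⇔ (+ a ≡ I - + k)
+-shift-⇔ k a I = mk⇔
  (λ eq → trans (sym (cancel (+ a) (+ k))) (cong (_- + k) (trans (sym (ℤP.pos-+ k a)) eq)))
  (λ eq → trans (ℤP.pos-+ k a) (trans (cong (_+_ (+ k)) eq) (restore I (+ k))))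
  where
  cancel : ∀ a k → k + a - k ≡ a
  cancel = solve-∀
  restore : ∀ I k → k + (I - k) ≡ I
  restore = solve-∀

K₁ K₂ K₃ K₄ K₅ K₆ : ℕ → ℤ → ℤ → ℤ
K₁ n I J = I * (I + + 1)
K₂ n I J = I * (+ 2 * J - + 1)
K₃ n I J = + 4 * I * (+ 3 * + n + + 5 - I - + 2 * J)
K₄ n I J = J * J
K₅ n I J = + 4 * (J - + 1) * (+ 3 * + n + + 4 - I - + 2 * J) + + 6 * + n + + 6 - + 2 * I - + 2 * J
K₆ n I J = + 4 * (+ 3 * + n + + 6 - I - + 2 * J) * (+ 3 * + n + + 5 - I - + 2 * J)

-- s (suc n) I J = recurrence n (s n) I J holds by definition.
recurrence : ℕ → (ℤ → ℤ → ℤ) → ℤ → ℤ → ℤ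
recurrence n u I J =
    K₁ n I J * u (I + + 1) (J - + 2)
  + K₂ n I J * u I (J - + 1)
  + K₃ n I J * u I (J - + 2)
  + K₄ n I J * u (I - + 1) J
  + K₅ n I J * u (I - + 1) (J - + 1)
  + K₆ n I J * u (I - + 1) (J - + 2)

recurrence-cong : ∀ n {u v} I J → (∀ I J → u I J ≡ v I J) → recurrence n u I J ≡ recurrence n v I J
recurrence-cong n {u} {v} I J eq
  rewrite eq (I + + 1) (J - + 2) | eq I (J - + 1) | eq I (J - + 2) | eq (I - + 1) J
        | eq (I - + 1) (J - + 1) | eq (I - + 1) (J - + 2) = refl

recurrence-zero : ∀ n I J → recurrence n (λ _ _ → + 0) I J ≡ + 0
recurrence-zero n I J = vanish (K₁ n I J) (K₂ n I J) (K₃ n I J) (K₄ n I J) (K₅ n I J) (K₆ n I J)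
  where
  vanish : ∀ k₁ k₂ k₃ k₄ k₅ k₆ → k₁ * + 0 + k₂ * + 0 + k₃ * + 0 + k₄ * + 0 + k₅ * + 0 + k₆ * + 0 ≡ + 0
  vanish = solve-∀

recurrence-∑ : ∀ n (u : X → ℤ → ℤ → ℤ) xs I J →
               recurrence n (λ I J → ∑ (λ x → u x I J) xs) I J ≡ ∑ (λ x → recurrence n (u x) I J) xs
recurrence-∑ n u [] I J = recurrence-zero n I J
recurrence-∑ n u (x ∷ xs) I J =
  trans (additive (K₁ n I J) (K₂ n I J) (K₃ n I J) (K₄ n I J) (K₅ n I J) (K₆ n I J)
                  (u x (I + + 1) (J - + 2)) (u x I (J - + 1)) (u x I (J - + 2))
                  (u x (I - + 1) J) (u x (I - + 1) (J - + 1)) (u x (I - + 1) (J - + 2)) _ _ _ _ _ _)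
        (cong (_+_ (recurrence n (u x) I J)) (recurrence-∑ n u xs I J))
  where
  additive : ∀ k₁ k₂ k₃ k₄ k₅ k₆ a₁ a₂ a₃ a₄ a₅ a₆ b₁ b₂ b₃ b₄ b₅ b₆ →
    k₁ * (a₁ + b₁) + k₂ * (a₂ + b₂) + k₃ * (a₃ + b₃) + k₄ * (a₄ + b₄) + k₅ * (a₅ + b₅) + k₆ * (a₆ + b₆)
    ≡ (k₁ * a₁ + k₂ * a₂ + k₃ * a₃ + k₄ * a₄ + k₅ * a₅ + k₆ * a₆)
      + (k₁ * b₁ + k₂ * b₂ + k₃ * b₃ + k₄ * b₄ + k₅ * b₅ + k₆ * b₆)
  additive = solve-∀

degree : ℕ → ℕ → ℕ → ℕ
degree i j e = i ℕ.+ 2 ℕ.* j ℕ.+ e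

degree-sucᵉ : ∀ i j e → degree i j (suc e) ≡ suc (degree i j e)
degree-sucᵉ i j e = ℕP.+-suc (i ℕ.+ 2 ℕ.* j) e

degree-sucʲ : ∀ i j e → degree i (suc j) e ≡ 2 ℕ.+ degree i j e
degree-sucʲ = shuffle
  where
  shuffle : ∀ i j e → i ℕ.+ 2 ℕ.* (1 ℕ.+ j) ℕ.+ e ≡ 2 ℕ.+ (i ℕ.+ 2 ℕ.* j ℕ.+ e)
  shuffle = ℕS.solve-∀

data OfDegree (d : ℕ) : Term → Set where
  null      : ∀ {c i j e} → c ≡ + 0 → OfDegree d (term c i j e)
  of-degree : ∀ {c i j e} → degree i j e ≡ d → OfDegree d (term c i j e)

-- Recording i ≥ 1 keeps the index i ∸ 1 of insertMaxTerms from truncating when comparing coefficients.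
data Admissible (n : ℕ) : Term → Set where
  null      : ∀ {c i j e} → c ≡ + 0 → Admissible n (term c i j e)
  of-degree : ∀ {c i j e} → degree (suc i) j e ≡ 3 ℕ.* n ℕ.+ 1 → Admissible n (term c (suc i) j e)

Admissible⇒OfDegree : ∀ {n t} → Admissible n t → OfDegree (3 ℕ.* n ℕ.+ 1) t
Admissible⇒OfDegree (null eq)      = null eq
Admissible⇒OfDegree (of-degree eq) = of-degree eq

OfDegree-insertMax : ∀ {d} t → OfDegree d t → All (OfDegree (suc d)) (insertMaxTerms t)
OfDegree-insertMax (term _ i j e) (null refl) = null refl ∷ null refl ∷ null refl ∷ []
OfDegree-insertMax {d} (term c i j e) (of-degree deg) =
  of-degree (trans (degree-sucᵉ i j e) (cong suc deg)) ∷ second e deg ∷ third i deg ∷ []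
  where
  second : ∀ e → degree i j e ≡ d → OfDegree (suc d) (term (c * (+ 2 * + e)) i (suc j) (e ∸ 1))
  second zero    _   = null (ℤP.*-zeroʳ c)
  second (suc e) deg = of-degree (trans (degree-sucʲ i j e) (cong suc (trans (sym (degree-sucᵉ i j e)) deg)))
  third : ∀ i → degree i j e ≡ d → OfDegree (suc d) (term (c * + i) (i ∸ 1) (suc j) e)
  third zero    _   = null (ℤP.*-zeroʳ c)
  third (suc i) deg = of-degree (trans (degree-sucʲ i j e) (cong suc deg))

Admissible-insertMaxPair : ∀ {n} t → OfDegree (suc (3 ℕ.* n ℕ.+ 1)) t → All (Admissible (suc n)) (insertMaxPairTerms t)
Admissible-insertMaxPair (term _ i j e) (null refl) = null refl ∷ null refl ∷ null refl ∷ []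
Admissible-insertMaxPair {n} (term c i j e) (of-degree deg) =
  of-degree (raise (cong suc (trans (degree-sucᵉ i j e) (cong suc deg)))) ∷ second e deg ∷ third i deg ∷ []
  where
  raise : ∀ {d} → d ≡ 3 ℕ.+ (3 ℕ.* n ℕ.+ 1) → d ≡ 3 ℕ.* suc n ℕ.+ 1
  raise eq = trans eq (cong (ℕ._+ 1) (sym (ℕP.*-suc 3 n)))
  second : ∀ e → degree i j e ≡ suc (3 ℕ.* n ℕ.+ 1) → Admissible (suc n) (term (c * (+ 2 * + e)) (suc i) (suc j) (e ∸ 1))
  second zero    _   = null (ℤP.*-zeroʳ c)
  second (suc e) deg =
    of-degree (raise (cong suc (trans (degree-sucʲ i j e) (cong (2 ℕ.+_) (ℕP.suc-injective (trans (sym (degree-sucᵉ i j e)) deg))))))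
  third : ∀ i → degree i j e ≡ suc (3 ℕ.* n ℕ.+ 1) → Admissible (suc n) (term (c * + i) i (suc j) e)
  third zero    _   = null (ℤP.*-zeroʳ c)
  third (suc i) deg = of-degree (raise (cong suc (trans (degree-sucʲ i j e) (cong (2 ℕ.+_) (ℕP.suc-injective deg)))))

expansion-admissible : ∀ n → All (Admissible n) (expansion n)
expansion-admissible zero    = of-degree refl ∷ []
expansion-admissible (suc n) =
  All-concatMap insertMaxPairTerms (Admissible-insertMaxPair _) (concatMap insertMaxTerms (expansion n))
    (All-concatMap insertMaxTerms (OfDegree-insertMax _) (expansion n)
      (All.map Admissible⇒OfDegree (expansion-admissible n)))

-- Each summand of the recurrence collects the coefficients of some of the nine terms that a term of degree 3n + 1 produces.
module Contributions (n : ℕ) (c : ℤ) (i j e : ℕ) (I J : ℤ) (deg : + suc i ≡ + 3 * + n + + 1 - + 2 * + j - + e) where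

  private
    t = term c (suc i) j e

  on-support : ∀ (K : ℤ → ℤ → ℤ) a b w → K (+ a) (+ b) * c ≡ w → K I J * (c * indicator a b I J) ≡ w * indicator a b I J
  on-support K a b w eq =
    trans (sym (ℤP.*-assoc (K I J) c _)) (*-indicator a b I J (λ p q → trans (cong₂ (λ I J → K I J * c) (sym p) (sym q)) eq))

  two-on-support : ∀ (K : ℤ → ℤ → ℤ) a b w₁ w₂ → K (+ a) (+ b) * c ≡ w₁ + w₂ →
                   K I J * (c * indicator a b I J) ≡ w₁ * indicator a b I J + w₂ * indicator a b I J
  two-on-support K a b w₁ w₂ eq = trans (on-support K a b (w₁ + w₂) eq) (ℤP.*-distribʳ-+ _ w₁ w₂)

  from-I+1,J-2 : K₁ n I J * coeffAt (I + + 1) (J - + 2) t ≡ c * + suc i * + i * indicator i (2 ℕ.+ j) I J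
  from-I+1,J-2 =
    trans (cong (λ x → K₁ n I J * (c * x)) (indicator-cong (+-suc-⇔ i I) (⇔-sym (+-shift-⇔ 2 j J))))
          (on-support (K₁ n) i (2 ℕ.+ j) _ (trans (identity (+ i) c) (cong (λ x → c * x * + i) (sym (ℤP.pos-+ 1 i)))))
    where
    identity : ∀ i c → i * (i + + 1) * c ≡ c * (+ 1 + i) * i
    identity = solve-∀

  from-I,J-1 : K₂ n I J * coeffAt I (J - + 1) t
               ≡ c * + j * + suc i * indicator (suc i) (suc j) I J + c * + suc i * + suc j * indicator (suc i) (suc j) I J
  from-I,J-1 =
    trans (cong (λ x → K₂ n I J * (c * x)) (indicator-cong (⇔-id _) (⇔-sym (+-shift-⇔ 1 j J))))
          (two-on-support (K₂ n) (suc i) (suc j) (c * + j * + suc i) (c * + suc i * + suc j) eq)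
    where
    identity : ∀ ι j c → ι * (+ 2 * (+ 1 + j) - + 1) * c ≡ c * j * ι + c * ι * (+ 1 + j)
    identity = solve-∀
    eq : K₂ n (+ suc i) (+ suc j) * c ≡ c * + j * + suc i + c * + suc i * + suc j
    eq = trans (cong (λ J → K₂ n (+ suc i) J * c) (ℤP.pos-+ 1 j))
               (trans (identity (+ suc i) (+ j) c) (cong (λ σ → c * + j * + suc i + c * + suc i * σ) (sym (ℤP.pos-+ 1 j))))

  from-I,J-2 : K₃ n I J * coeffAt I (J - + 2) t
               ≡ c * (+ 2 * + e) * + suc i * indicator (suc i) (2 ℕ.+ j) I J + c * + suc i * (+ 2 * + e) * indicator (suc i) (2 ℕ.+ j) I J
  from-I,J-2 =
    trans (cong (λ x → K₃ n I J * (c * x)) (indicator-cong (⇔-id _) (⇔-sym (+-shift-⇔ 2 j J))))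
          (two-on-support (K₃ n) (suc i) (2 ℕ.+ j) (c * (+ 2 * + e) * + suc i) (c * + suc i * (+ 2 * + e)) eq)
    where
    identity : ∀ n j e c → let ι = + 3 * n + + 1 - + 2 * j - e in
      + 4 * ι * (+ 3 * n + + 5 - ι - + 2 * (+ 2 + j)) * c ≡ c * (+ 2 * e) * ι + c * ι * (+ 2 * e)
    identity = solve-∀
    eq : K₃ n (+ suc i) (+ (2 ℕ.+ j)) * c ≡ c * (+ 2 * + e) * + suc i + c * + suc i * (+ 2 * + e)
    eq = trans (cong₂ (λ I J → K₃ n I J * c) deg (ℤP.pos-+ 2 j))
               (trans (identity (+ n) (+ j) (+ e) c) (cong (λ ι → c * (+ 2 * + e) * ι + c * ι * (+ 2 * + e)) (sym deg)))

  from-I-1,J : K₄ n I J * coeffAt (I - + 1) J t ≡ c * + j * + j * indicator (2 ℕ.+ i) j I J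
  from-I-1,J =
    trans (cong (λ x → K₄ n I J * (c * x)) (indicator-cong (⇔-sym (+-shift-⇔ 1 (suc i) I)) (⇔-id _)))
          (on-support (K₄ n) (2 ℕ.+ i) j _ (identity (+ j) c))
    where
    identity : ∀ j c → j * j * c ≡ c * j * j
    identity = solve-∀

  from-I-1,J-1 : K₅ n I J * coeffAt (I - + 1) (J - + 1) t
                 ≡ c * + j * (+ 2 * + suc e) * indicator (2 ℕ.+ i) (suc j) I J
                   + c * (+ 2 * + e) * + suc j * indicator (2 ℕ.+ i) (suc j) I J
  from-I-1,J-1 =
    trans (cong (λ x → K₅ n I J * (c * x)) (indicator-cong (⇔-sym (+-shift-⇔ 1 (suc i) I)) (⇔-sym (+-shift-⇔ 1 j J))))
          (two-on-support (K₅ n) (2 ℕ.+ i) (suc j) (c * + j * (+ 2 * + suc e)) (c * (+ 2 * + e) * + suc j) eq)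
    where
    identity : ∀ n j e c → let ι = + 3 * n + + 1 - + 2 * j - e in
      (+ 4 * (+ 1 + j - + 1) * (+ 3 * n + + 4 - (+ 1 + ι) - + 2 * (+ 1 + j)) + + 6 * n + + 6 - + 2 * (+ 1 + ι) - + 2 * (+ 1 + j)) * c
      ≡ c * j * (+ 2 * (+ 1 + e)) + c * (+ 2 * e) * (+ 1 + j)
    identity = solve-∀
    eq : K₅ n (+ (2 ℕ.+ i)) (+ suc j) * c ≡ c * + j * (+ 2 * + suc e) + c * (+ 2 * + e) * + suc j
    eq = trans (cong₂ (λ I J → K₅ n I J * c) (trans (ℤP.pos-+ 1 (suc i)) (cong (_+_ (+ 1)) deg)) (ℤP.pos-+ 1 j))
               (trans (identity (+ n) (+ j) (+ e) c)
                      (cong₂ (λ σ τ → c * + j * (+ 2 * σ) + c * (+ 2 * + e) * τ) (sym (ℤP.pos-+ 1 e)) (sym (ℤP.pos-+ 1 j))))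

  from-I-1,J-2 : K₆ n I J * coeffAt (I - + 1) (J - + 2) t ≡ c * (+ 2 * + e) * (+ 2 * + (e ∸ 1)) * indicator (2 ℕ.+ i) (2 ℕ.+ j) I J
  from-I-1,J-2 =
    trans (cong (λ x → K₆ n I J * (c * x)) (indicator-cong (⇔-sym (+-shift-⇔ 1 (suc i) I)) (⇔-sym (+-shift-⇔ 2 j J))))
          (on-support (K₆ n) (2 ℕ.+ i) (2 ℕ.+ j) _ (trans eq (truncate e)))
    where
    identity : ∀ n j e c → let ι = + 3 * n + + 1 - + 2 * j - e in
      + 4 * (+ 3 * n + + 6 - (+ 1 + ι) - + 2 * (+ 2 + j)) * (+ 3 * n + + 5 - (+ 1 + ι) - + 2 * (+ 2 + j)) * c
      ≡ c * (+ 2 * e) * (+ 2 * (e - + 1))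
    identity = solve-∀
    eq : K₆ n (+ (2 ℕ.+ i)) (+ (2 ℕ.+ j)) * c ≡ c * (+ 2 * + e) * (+ 2 * (+ e - + 1))
    eq = trans (cong₂ (λ I J → K₆ n I J * c) (trans (ℤP.pos-+ 1 (suc i)) (cong (_+_ (+ 1)) deg)) (ℤP.pos-+ 2 j))
               (identity (+ n) (+ j) (+ e) c)
    truncate : ∀ e → c * (+ 2 * + e) * (+ 2 * (+ e - + 1)) ≡ c * (+ 2 * + e) * (+ 2 * + (e ∸ 1))
    truncate zero    = trans (cong (λ x → x * (+ 2 * (+ 0 - + 1))) (ℤP.*-zeroʳ c)) (sym (cong (_* + 0) (ℤP.*-zeroʳ c)))
    truncate (suc e) = cong (λ x → c * (+ 2 * + suc e) * (+ 2 * x)) (trans (cong (_- + 1) (ℤP.pos-+ 1 e)) (lower (+ e)))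
      where
      lower : ∀ x → + 1 + x - + 1 ≡ x
      lower = solve-∀

  coeffAt-insert : ∑ (λ t′ → ∑ (coeffAt I J) (insertMaxPairTerms t′)) (insertMaxTerms t)
                   ≡ recurrence n (λ I J → coeffAt I J t) I J
  coeffAt-insert =
    sym (trans (cong₂ _+_ (cong₂ _+_ (cong₂ _+_ (cong₂ _+_ (cong₂ _+_ from-I+1,J-2 from-I,J-1) from-I,J-2) from-I-1,J)
                                     from-I-1,J-1)
                          from-I-1,J-2)
               (regroup (c * + j * + j * indicator (2 ℕ.+ i) j I J)
                        (c * + j * (+ 2 * + suc e) * indicator (2 ℕ.+ i) (suc j) I J)
                        (c * + j * + suc i * indicator (suc i) (suc j) I J)
                        (c * (+ 2 * + e) * + suc j * indicator (2 ℕ.+ i) (suc j) I J)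
                        (c * (+ 2 * + e) * (+ 2 * + (e ∸ 1)) * indicator (2 ℕ.+ i) (2 ℕ.+ j) I J)
                        (c * (+ 2 * + e) * + suc i * indicator (suc i) (2 ℕ.+ j) I J)
                        (c * + suc i * + suc j * indicator (suc i) (suc j) I J)
                        (c * + suc i * (+ 2 * + e) * indicator (suc i) (2 ℕ.+ j) I J)
                        (c * + suc i * + i * indicator i (2 ℕ.+ j) I J)))
    where
    regroup : ∀ a₁ a₂ a₃ b₁ b₂ b₃ c₁ c₂ c₃ →
      c₃ + (a₃ + c₁) + (b₃ + c₂) + a₁ + (a₂ + b₁) + b₂
      ≡ (a₁ + (a₂ + (a₃ + + 0))) + ((b₁ + (b₂ + (b₃ + + 0))) + ((c₁ + (c₂ + (c₃ + + 0))) + + 0))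
    regroup = solve-∀

degree-ℤ : ∀ {n i j e} → degree i j e ≡ 3 ℕ.* n ℕ.+ 1 → + i ≡ + 3 * + n + + 1 - + 2 * + j - + e
degree-ℤ {n} {i} {j} {e} deg =
  trans (isolate (+ i) (+ j) (+ e)) (cong (λ d → d - + 2 * + j - + e) (trans (sym pos-degree) (trans (cong +_ deg) pos-3n+1)))
  where
  isolate : ∀ i j e → i ≡ i + + 2 * j + e - + 2 * j - e
  isolate = solve-∀
  pos-degree : + degree i j e ≡ + i + + 2 * + j + + e
  pos-degree = trans (ℤP.pos-+ (i ℕ.+ 2 ℕ.* j) e) (cong (_+ + e) (trans (ℤP.pos-+ i (2 ℕ.* j)) (cong (_+_ (+ i)) (ℤP.pos-* 2 j))))
  pos-3n+1 : + (3 ℕ.* n ℕ.+ 1) ≡ + 3 * + n + + 1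
  pos-3n+1 = trans (ℤP.pos-+ (3 ℕ.* n) 1) (cong (_+ + 1) (ℤP.pos-* 3 n))

coeffAt-insert : ∀ n I J {t} → Admissible n t →
                 ∑ (λ t′ → ∑ (coeffAt I J) (insertMaxPairTerms t′)) (insertMaxTerms t) ≡ recurrence n (λ I J → coeffAt I J t) I J
coeffAt-insert n I J (null refl) = sym (recurrence-zero n I J)
coeffAt-insert n I J {term c (suc i) j e} (of-degree deg) = Contributions.coeffAt-insert n c i j e I J (degree-ℤ {n} {suc i} {j} {e} deg)

coefficient≡s : ∀ n I J → coefficient n I J ≡ s n I J
coefficient≡s zero I J =
  trans (trans (ℤP.+-identityʳ _) (ℤP.*-identityˡ _))
        (cong₂ (λ u v → if u ∧ v then + 1 else + 0)
               (⌊⌋-⇔ (mk⇔ sym sym) (+ 1 ℤ.≟ I) (I ℤ.≟ + 1)) (⌊⌋-⇔ (mk⇔ sym sym) (+ 0 ℤ.≟ J) (J ℤ.≟ + 0)))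
coefficient≡s (suc n) I J = begin
    ∑ (coeffAt I J) (concatMap insertMaxPairTerms (concatMap insertMaxTerms (expansion n)))
  ≡⟨ ∑-concatMap (coeffAt I J) insertMaxPairTerms (concatMap insertMaxTerms (expansion n)) ⟩
    ∑ (λ t′ → ∑ (coeffAt I J) (insertMaxPairTerms t′)) (concatMap insertMaxTerms (expansion n))
  ≡⟨ ∑-concatMap (λ t′ → ∑ (coeffAt I J) (insertMaxPairTerms t′)) insertMaxTerms (expansion n) ⟩
    ∑ (λ t → ∑ (λ t′ → ∑ (coeffAt I J) (insertMaxPairTerms t′)) (insertMaxTerms t)) (expansion n)
  ≡⟨ ∑-cong (expansion n) (All.map (coeffAt-insert n I J) (expansion-admissible n)) ⟩
    ∑ (λ t → recurrence n (λ I J → coeffAt I J t) I J) (expansion n)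
  ≡⟨ recurrence-∑ n (λ t I J → coeffAt I J t) (expansion n) I J ⟨
    recurrence n (coefficient n) I J
  ≡⟨ recurrence-cong n I J (coefficient≡s n) ⟩
    s (suc n) I J
  ∎
  where open ≡-Reasoning

data Bounded (m : ℕ) : Term → Set where
  null    : ∀ {c i j e} → c ≡ + 0 → Bounded m (term c i j e)
  bounded : ∀ {c i j e} → i ≤ m → Bounded m (term c i (suc j) e)

data InBox (m : ℕ) : Term → Set where
  null     : ∀ {c i j e} → c ≡ + 0 → InBox m (term c i j e)
  in-box : ∀ {c i j e} → i < m → InBox m (term c (suc i) (suc j) e)

InBox⇒Bounded : ∀ {m t} → InBox m t → Bounded m t
InBox⇒Bounded (null eq)      = null eq
InBox⇒Bounded (in-box i<m) = bounded i<m

Bounded-insertMax : ∀ {m} t → Bounded m t → All (Bounded m) (insertMaxTerms t)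
Bounded-insertMax (term _ i j e) (null refl) = null refl ∷ null refl ∷ null refl ∷ []
Bounded-insertMax (term c i (suc j) e) (bounded i≤m) =
  bounded i≤m ∷ bounded i≤m ∷ bounded (ℕP.≤-trans (ℕP.m∸n≤m i 1) i≤m) ∷ []

InBox-insertMaxPair : ∀ {m} t → Bounded m t → All (InBox (suc m)) (insertMaxPairTerms t)
InBox-insertMaxPair (term _ i j e) (null refl) = null refl ∷ null refl ∷ null refl ∷ []
InBox-insertMaxPair (term c i (suc j) e) (bounded i≤m) = in-box (s≤s i≤m) ∷ in-box (s≤s i≤m) ∷ third i i≤m ∷ []
  where
  third : ∀ {m} i → i ≤ m → InBox (suc m) (term (c * + i) i (suc (suc j)) e)
  third zero    _   = null (ℤP.*-zeroʳ c)
  third (suc i) i≤m = in-box (ℕP.m≤n⇒m≤1+n i≤m)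

expansion-inBox : ∀ n → All (InBox (suc n)) (expansion (suc n))
expansion-inBox zero =
  All-concatMap insertMaxPairTerms (InBox-insertMaxPair _) (insertMaxTerms (term (+ 1) 1 0 0)) (null refl ∷ null refl ∷ bounded z≤n ∷ [])
expansion-inBox (suc n) =
  All-concatMap insertMaxPairTerms (InBox-insertMaxPair _) (concatMap insertMaxTerms (expansion (suc n)))
    (All-concatMap insertMaxTerms (Bounded-insertMax _) (expansion (suc n))
      (All.map InBox⇒Bounded (expansion-inBox n)))

monomial : ℤ → ℤ → ℤ → Weight
monomial x y z a d p = x ^ a * y ^ d * z ^ p

binomialSum-monomial : ∀ x y α β e w → binomialSum α β e (λ a d → x ^ a * y ^ d * w) ≡ x ^ α * y ^ β * (x + y) ^ e * w
binomialSum-monomial x y α β zero    w = cong (_* w) (sym (ℤP.*-identityʳ (x ^ α * y ^ β)))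
binomialSum-monomial x y α β (suc e) w
  rewrite binomialSum-monomial x y (suc α) β e w | binomialSum-monomial x y α (suc β) e w =
  factor x y (x ^ α) (y ^ β) ((x + y) ^ e) w
  where
  factor : ∀ x y a b p w → x * a * b * p * w + a * (y * b) * p * w ≡ a * b * ((x + y) * p) * w
  factor = solve-∀

^-distrib-* : ∀ x y j → (x * y) ^ j ≡ x ^ j * y ^ j
^-distrib-* x y zero    = refl
^-distrib-* x y (suc j) rewrite ^-distrib-* x y j = interchange x y (x ^ j) (y ^ j)
  where
  interchange : ∀ x y a b → x * y * (a * b) ≡ x * a * (y * b)
  interchange = solve-∀

evalBasis-monomial : ∀ x y z i j e → evalBasis i j e (monomial x y z) ≡ (x * y) ^ j * (x + y) ^ e * z ^ i
evalBasis-monomial x y z i j e =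
  trans (binomialSum-monomial x y j j e (z ^ i)) (cong (λ p → p * (x + y) ^ e * z ^ i) (sym (^-distrib-* x y j)))

⌊2*n/2⌋≡n : ∀ n → ⌊ 2 ℕ.* n /2⌋ ≡ n
⌊2*n/2⌋≡n zero    = refl
⌊2*n/2⌋≡n (suc n) = trans (cong (λ m → ⌊ suc m /2⌋) (ℕP.+-suc n (n ℕ.+ 0))) (cong suc (⌊2*n/2⌋≡n n))

module Box (n : ℕ) (x y z : ℤ) where

  E : ℕ → ℕ → ℕ
  E i j = 3 ℕ.* n ℕ.+ 1 ∸ i ∸ 2 ℕ.* j

  K : ℕ → ℕ
  K i = ⌊ (3 ℕ.* n ℕ.+ 1 ∸ i) /2⌋

  boxSum : (ℕ → ℕ → ℤ) → ℤ
  boxSum u = ∑ (λ i → z ^ i * ∑ (λ j → u i j * (x * y) ^ j * (x + y) ^ E i j) (oneTo (K i))) (oneTo n)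

  boxSum-cong : ∀ {u v} → (∀ i j → u i j ≡ v i j) → boxSum u ≡ boxSum v
  boxSum-cong eq =
    ∑-congᵖ (λ i → cong (z ^ i *_) (∑-congᵖ (λ j → cong (λ w → w * (x * y) ^ j * (x + y) ^ E i j) (eq i j)) (oneTo (K i)))) (oneTo n)

  boxSum-zero : boxSum (λ _ _ → + 0) ≡ + 0
  boxSum-zero =
    trans (∑-congᵖ (λ i → trans (cong (z ^ i *_) (∑-zero (oneTo (K i)))) (ℤP.*-zeroʳ (z ^ i))) (oneTo n)) (∑-zero (oneTo n))

  boxSum-∑ : (u : X → ℕ → ℕ → ℤ) (ts : List X) → boxSum (λ i j → ∑ (λ t → u t i j) ts) ≡ ∑ (λ t → boxSum (u t)) ts
  boxSum-∑ u ts = begin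
      ∑ (λ i → z ^ i * ∑ (λ j → ∑ (λ t → u t i j) ts * P j * Q i j) (oneTo (K i))) (oneTo n)
    ≡⟨ ∑-congᵖ (λ i → cong (z ^ i *_) (∑-congᵖ (λ j → pull-in i j) (oneTo (K i)))) (oneTo n) ⟩
      ∑ (λ i → z ^ i * ∑ (λ j → ∑ (λ t → u t i j * P j * Q i j) ts) (oneTo (K i))) (oneTo n)
    ≡⟨ ∑-congᵖ (λ i → cong (z ^ i *_) (∑-comm (λ j t → u t i j * P j * Q i j) (oneTo (K i)) ts)) (oneTo n) ⟩
      ∑ (λ i → z ^ i * ∑ (λ t → ∑ (λ j → u t i j * P j * Q i j) (oneTo (K i))) ts) (oneTo n)
    ≡⟨ ∑-congᵖ (λ i → sym (∑-*ˡ (z ^ i) (λ t → ∑ (λ j → u t i j * P j * Q i j) (oneTo (K i))) ts)) (oneTo n) ⟩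
      ∑ (λ i → ∑ (λ t → z ^ i * ∑ (λ j → u t i j * P j * Q i j) (oneTo (K i))) ts) (oneTo n)
    ≡⟨ ∑-comm (λ i t → z ^ i * ∑ (λ j → u t i j * P j * Q i j) (oneTo (K i))) (oneTo n) ts ⟩
      ∑ (λ t → boxSum (u t)) ts
    ∎
    where
    open ≡-Reasoning
    P : ℕ → ℤ
    P j = (x * y) ^ j
    Q : ℕ → ℕ → ℤ
    Q i j = (x + y) ^ E i j
    pull-in : ∀ i j → ∑ (λ t → u t i j) ts * P j * Q i j ≡ ∑ (λ t → u t i j * P j * Q i j) ts
    pull-in i j = sym (trans (∑-*ʳ (Q i j) (λ t → u t i j * P j) ts) (cong (_* Q i j) (∑-*ʳ (P j) (λ t → u t i j) ts)))

  degree⇒exponents : ∀ {a b e} → degree a b e ≡ 3 ℕ.* n ℕ.+ 1 → E a b ≡ e × b ≤ K a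
  degree⇒exponents {a} {b} {e} deg = E≡e , b≤K
    where
    rest : 3 ℕ.* n ℕ.+ 1 ∸ a ≡ 2 ℕ.* b ℕ.+ e
    rest = trans (cong (_∸ a) (sym deg)) (trans (cong (_∸ a) (ℕP.+-assoc a (2 ℕ.* b) e)) (ℕP.m+n∸m≡n a _))
    E≡e : E a b ≡ e
    E≡e = trans (cong (_∸ 2 ℕ.* b) rest) (ℕP.m+n∸m≡n (2 ℕ.* b) e)
    b≤K : b ≤ K a
    b≤K = subst (_≤ K a) (⌊2*n/2⌋≡n b)
                (subst (λ m → ⌊ 2 ℕ.* b /2⌋ ≤ ⌊ m /2⌋) (sym rest) (ℕP.⌊n/2⌋-mono (ℕP.m≤m+n (2 ℕ.* b) e)))

  boxSum-term : ∀ {t} → Admissible n t → InBox n t → boxSum (λ i j → coeffAt (+ i) (+ j) t) ≡ evalTerm (monomial x y z) t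
  boxSum-term (null refl) _ = boxSum-zero
  boxSum-term (of-degree _) (null refl) = boxSum-zero
  boxSum-term {term c (suc a) (suc b) e} (of-degree deg) (in-box a<n) = begin
      ∑ F (oneTo n)
    ≡⟨ ∑-oneTo-single n (suc a) F (s≤s z≤n) a<n F-vanishes ⟩
      z ^ suc a * ∑ G (oneTo (K (suc a)))
    ≡⟨ cong (z ^ suc a *_) (∑-oneTo-single (K (suc a)) (suc b) G (s≤s z≤n) (proj₂ exponents) G-vanishes) ⟩
      z ^ suc a * (c * indicator (suc a) (suc b) (+ suc a) (+ suc b) * (x * y) ^ suc b * (x + y) ^ E (suc a) (suc b))
    ≡⟨ cong₂ (λ δ d → z ^ suc a * (c * δ * (x * y) ^ suc b * (x + y) ^ d)) (indicator-diag (suc a) (suc b)) (proj₁ exponents) ⟩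
      z ^ suc a * (c * + 1 * (x * y) ^ suc b * (x + y) ^ e)
    ≡⟨ reorder (z ^ suc a) c ((x * y) ^ suc b) ((x + y) ^ e) ⟩
      c * ((x * y) ^ suc b * (x + y) ^ e * z ^ suc a)
    ≡⟨ cong (c *_) (evalBasis-monomial x y z (suc a) (suc b) e) ⟨
      c * evalBasis (suc a) (suc b) e (monomial x y z)
    ∎
    where
    open ≡-Reasoning
    F : ℕ → ℤ
    F i = z ^ i * ∑ (λ j → c * indicator (suc a) (suc b) (+ i) (+ j) * (x * y) ^ j * (x + y) ^ E i j) (oneTo (K i))
    G : ℕ → ℤ
    G j = c * indicator (suc a) (suc b) (+ suc a) (+ j) * (x * y) ^ j * (x + y) ^ E (suc a) j
    exponents : E (suc a) (suc b) ≡ e × suc b ≤ K (suc a)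
    exponents = degree⇒exponents {suc a} {suc b} {e} deg
    vanish : ∀ c p q → c * + 0 * p * q ≡ + 0
    vanish = solve-∀
    F-vanishes : ∀ k → k ≢ suc a → F k ≡ + 0
    F-vanishes k k≢a =
      trans (cong (z ^ k *_) (trans (∑-congᵖ (λ j → trans (cong (λ δ → c * δ * (x * y) ^ j * (x + y) ^ E k j) (indicator-≢ˡ (suc a) (suc b) k (+ j) k≢a))
                                                         (vanish c _ _)) (oneTo (K k)))
                                    (∑-zero (oneTo (K k)))))
            (ℤP.*-zeroʳ (z ^ k))
    G-vanishes : ∀ l → l ≢ suc b → G l ≡ + 0
    G-vanishes l l≢b =
      trans (cong (λ δ → c * δ * (x * y) ^ l * (x + y) ^ E (suc a) l) (indicator-≢ʳ (suc a) (suc b) (+ suc a) l l≢b)) (vanish c _ _)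
    reorder : ∀ Z c P Q → Z * (c * + 1 * P * Q) ≡ c * (P * Q * Z)
    reorder = solve-∀

RHS≡evalTerms : ∀ n x y z → RHS (suc n) x y z ≡ evalTerms (monomial x y z) (expansion (suc n))
RHS≡evalTerms n x y z = begin
    boxSum (λ i j → s (suc n) (+ i) (+ j))
  ≡⟨ boxSum-cong (λ i j → coefficient≡s (suc n) (+ i) (+ j)) ⟨
    boxSum (λ i j → ∑ (coeffAt (+ i) (+ j)) (expansion (suc n)))
  ≡⟨ boxSum-∑ (λ t i j → coeffAt (+ i) (+ j) t) (expansion (suc n)) ⟩
    ∑ (λ t → boxSum (λ i j → coeffAt (+ i) (+ j) t)) (expansion (suc n))
  ≡⟨ ∑-cong (expansion (suc n)) (All.zipWith (uncurry boxSum-term) (expansion-admissible (suc n) , expansion-inBox n)) ⟩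
    evalTerms (monomial x y z) (expansion (suc n))
  ∎
  where
  open ≡-Reasoning
  open Box (suc n) x y z

-- Inserting letters into words

ascents descents plateaus : List ℕ → ℕ
ascents  = countAdj (λ a b → ⌊ a ℕ.<? b ⌋)
descents = countAdj (λ a b → ⌊ b ℕ.<? a ⌋)
plateaus = countAdj (λ a b → ⌊ a ℕ.≟ b ⌋)

stat : Weight → List ℕ → ℤ
stat f w = f (ascents w) (descents w) (plateaus w)

shift : ℕ → ℕ → ℕ → Weight → Weight
shift a₀ d₀ p₀ f a d p = f (a₀ ℕ.+ a) (d₀ ℕ.+ d) (p₀ ℕ.+ p)

δ : Bool → ℕ
δ b = if b then 1 else 0

data Step : ℕ → ℕ → ℕ → Set where
  ascent  : Step 1 0 0
  descent : Step 0 1 0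
  plateau : Step 0 0 1

step : ∀ u v → Step (δ ⌊ u ℕ.<? v ⌋) (δ ⌊ v ℕ.<? u ⌋) (δ ⌊ u ℕ.≟ v ⌋)
step u v with ℕP.<-cmp u v
... | tri< u<v u≢v v≮u rewrite ⌊⌋-true (u ℕ.<? v) u<v | ⌊⌋-false (v ℕ.<? u) v≮u | ⌊⌋-false (u ℕ.≟ v) u≢v = ascent
... | tri≈ u≮v u≡v v≮u rewrite ⌊⌋-false (u ℕ.<? v) u≮v | ⌊⌋-false (v ℕ.<? u) v≮u | ⌊⌋-true (u ℕ.≟ v) u≡v = plateau
... | tri> u≮v u≢v v<u rewrite ⌊⌋-false (u ℕ.<? v) u≮v | ⌊⌋-true (v ℕ.<? u) v<u | ⌊⌋-false (u ℕ.≟ v) u≢v = descent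

*-pred-suc : ∀ p (g : ℕ → ℤ) → + p * g (suc (p ∸ 1)) ≡ + p * g p
*-pred-suc zero    g = refl
*-pred-suc (suc p) g = refl

-- Splitting off the first gap of a word: a new largest letter placed in that gap is a peak, of weight f (A + 1) (D + 1) P.
insertMax-shift : ∀ f {a₀ d₀ p₀} → Step a₀ d₀ p₀ → ∀ A D P →
                  f (suc A) (suc D) P + insertMax (shift a₀ d₀ p₀ f) A D P ≡ insertMax f (a₀ ℕ.+ A) (d₀ ℕ.+ D) (p₀ ℕ.+ P)
insertMax-shift f ascent A D P rewrite ℤP.pos-+ 1 A =
  collect (+ A) (+ D) (+ P) (f (suc A) (suc D) P) (f (suc (suc A)) D P) (f (suc (suc A)) (suc D) (P ∸ 1))
  where
  collect : ∀ a d p x y w → x + (a * x + d * y + p * w) ≡ (+ 1 + a) * x + d * y + p * w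
  collect = solve-∀
insertMax-shift f descent A D P rewrite ℤP.pos-+ 1 D =
  collect (+ A) (+ D) (+ P) (f (suc A) (suc D) P) (f A (suc (suc D)) P) (f (suc A) (suc (suc D)) (P ∸ 1))
  where
  collect : ∀ a d p x y w → x + (a * y + d * x + p * w) ≡ a * y + (+ 1 + d) * x + p * w
  collect = solve-∀
insertMax-shift f plateau A D P rewrite *-pred-suc P (f (suc A) (suc D)) | ℤP.pos-+ 1 P =
  collect (+ A) (+ D) (+ P) (f (suc A) (suc D) P) (f A (suc D) (suc P)) (f (suc A) D (suc P))
  where
  collect : ∀ a d p x y w → x + (a * y + d * w + p * x) ≡ a * y + d * w + (+ 1 + p) * x
  collect = solve-∀

insertMaxPair≗insertMax : ∀ f A D P → insertMaxPair f A D P ≡ insertMax (shift 0 0 1 f) A D P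
insertMaxPair≗insertMax f A D P = cong (_+_ (+ A * f A (suc D) (suc P) + + D * f (suc A) D (suc P))) (sym (*-pred-suc P (f (suc A) (suc D))))

insertMaxPair-shift : ∀ f {a₀ d₀ p₀} → Step a₀ d₀ p₀ → ∀ A D P →
                      f (suc A) (suc D) (suc P) + insertMaxPair (shift a₀ d₀ p₀ f) A D P
                      ≡ insertMaxPair f (a₀ ℕ.+ A) (d₀ ℕ.+ D) (p₀ ℕ.+ P)
insertMaxPair-shift f {a₀} {d₀} {p₀} s A D P =
  trans (cong (_+_ (f (suc A) (suc D) (suc P))) (trans (insertMaxPair≗insertMax (shift a₀ d₀ p₀ f) A D P) (shift-comm s)))
        (trans (insertMax-shift (shift 0 0 1 f) s A D P) (sym (insertMaxPair≗insertMax f (a₀ ℕ.+ A) (d₀ ℕ.+ D) (p₀ ℕ.+ P))))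
  where
  shift-comm : ∀ {a₀ d₀ p₀} → Step a₀ d₀ p₀ →
               insertMax (shift 0 0 1 (shift a₀ d₀ p₀ f)) A D P ≡ insertMax (shift a₀ d₀ p₀ (shift 0 0 1 f)) A D P
  shift-comm ascent  = refl
  shift-comm descent = refl
  shift-comm plateau = refl

insertions insertionsBefore : List ℕ → List ℕ → List (List ℕ)
insertions       blk []      = blk ∷ []
insertions       blk (v ∷ r) = (blk ++ v ∷ r) ∷ map (v ∷_) (insertions blk r)
insertionsBefore blk []      = []
insertionsBefore blk (v ∷ r) = (blk ++ v ∷ r) ∷ map (v ∷_) (insertionsBefore blk r)

insertions-++-[0] : ∀ blk π → map (_++ 0 ∷ []) (insertions blk π) ≡ insertionsBefore blk (π ++ 0 ∷ [])
insertions-++-[0] blk []      = refl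
insertions-++-[0] blk (v ∷ π) =
  cong₂ _∷_ (ListP.++-assoc blk (v ∷ π) (0 ∷ []))
            (trans (sym (ListP.map-∘ (insertions blk π)))
                   (trans (ListP.map-∘ (insertions blk π)) (cong (map (v ∷_)) (insertions-++-[0] blk π))))

stat-peak : ∀ f {u b v} r → u < b → v < b →
            stat f (u ∷ b ∷ v ∷ r) ≡ f (suc (ascents (v ∷ r))) (suc (descents (v ∷ r))) (plateaus (v ∷ r))
stat-peak f {u} {b} {v} r u<b v<b
  rewrite ⌊⌋-true (u ℕ.<? b) u<b | ⌊⌋-false (b ℕ.<? u) (ℕP.<-asym u<b) | ⌊⌋-false (u ℕ.≟ b) (ℕP.<⇒≢ u<b)
        | ⌊⌋-false (b ℕ.<? v) (ℕP.<-asym v<b) | ⌊⌋-true (v ℕ.<? b) v<b | ⌊⌋-false (b ℕ.≟ v) (ℕP.>⇒≢ v<b) = refl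

stat-peak₂ : ∀ f {u M v} r → u < M → v < M →
             stat f (u ∷ M ∷ M ∷ v ∷ r) ≡ f (suc (ascents (v ∷ r))) (suc (descents (v ∷ r))) (suc (plateaus (v ∷ r)))
stat-peak₂ f {u} {M} {v} r u<M v<M
  rewrite ⌊⌋-true (u ℕ.<? M) u<M | ⌊⌋-false (M ℕ.<? u) (ℕP.<-asym u<M) | ⌊⌋-false (u ℕ.≟ M) (ℕP.<⇒≢ u<M)
        | ⌊⌋-false (M ℕ.<? M) (ℕP.<-irrefl refl) | ⌊⌋-true (M ℕ.≟ M) refl
        | ⌊⌋-false (M ℕ.<? v) (ℕP.<-asym v<M) | ⌊⌋-true (v ℕ.<? M) v<M | ⌊⌋-false (M ℕ.≟ v) (ℕP.>⇒≢ v<M) = refl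

∑-insertionsBefore-max : ∀ f b u r → All (_< b) (u ∷ r) →
  ∑ (λ w → stat f (u ∷ w)) (insertionsBefore (b ∷ []) r) ≡ insertMax f (ascents (u ∷ r)) (descents (u ∷ r)) (plateaus (u ∷ r))
∑-insertionsBefore-max f b u []      _                   = refl
∑-insertionsBefore-max f b u (v ∷ r) (u<b ∷ v<b ∷ r<b) =
  trans (cong₂ _+_ (stat-peak f r u<b v<b)
                   (trans (∑-map (λ w → stat f (u ∷ w)) (v ∷_) (insertionsBefore (b ∷ []) r))
                          (∑-insertionsBefore-max (shift _ _ _ f) b v r (v<b ∷ r<b))))
        (insertMax-shift f (step u v) _ _ _)

∑-insertionsBefore-maxPair : ∀ f M u r → All (_< M) (u ∷ r) →
  ∑ (λ w → stat f (u ∷ w)) (insertionsBefore (M ∷ M ∷ []) r) ≡ insertMaxPair f (ascents (u ∷ r)) (descents (u ∷ r)) (plateaus (u ∷ r))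
∑-insertionsBefore-maxPair f M u []      _                   = refl
∑-insertionsBefore-maxPair f M u (v ∷ r) (u<M ∷ v<M ∷ r<M) =
  trans (cong₂ _+_ (stat-peak₂ f r u<M v<M)
                   (trans (∑-map (λ w → stat f (u ∷ w)) (v ∷_) (insertionsBefore (M ∷ M ∷ []) r))
                          (∑-insertionsBefore-maxPair (shift _ _ _ f) M v r (v<M ∷ r<M))))
        (insertMaxPair-shift f (step u v) _ _ _)

∑-insertions : ∀ f blk π →
  ∑ (λ w → stat f (padded w)) (insertions blk π) ≡ ∑ (λ w → stat f (0 ∷ w)) (insertionsBefore blk (π ++ 0 ∷ []))
∑-insertions f blk π =
  trans (sym (∑-map (λ w → stat f (0 ∷ w)) (_++ 0 ∷ []) (insertions blk π)))
        (cong (∑ (λ w → stat f (0 ∷ w))) (insertions-++-[0] blk π))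

∑-insertions-max : ∀ f b π → 0 < b → All (_< b) π →
  ∑ (λ w → stat f (padded w)) (insertions (b ∷ []) π) ≡ insertMax f (asc π) (des π) (plat π)
∑-insertions-max f b π 0<b π<b =
  trans (∑-insertions f (b ∷ []) π) (∑-insertionsBefore-max f b 0 (π ++ 0 ∷ []) (0<b ∷ AllP.++⁺ π<b (0<b ∷ [])))

∑-insertions-maxPair : ∀ f M π → 0 < M → All (_< M) π →
  ∑ (λ w → stat f (padded w)) (insertions (M ∷ M ∷ []) π) ≡ insertMaxPair f (asc π) (des π) (plat π)
∑-insertions-maxPair f M π 0<M π<M =
  trans (∑-insertions f (M ∷ M ∷ []) π) (∑-insertionsBefore-maxPair f M 0 (π ++ 0 ∷ []) (0<M ∷ AllP.++⁺ π<M (0<M ∷ [])))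

All-insertions : {P : ℕ → Set} → ∀ blk π → All P blk → All P π → All (All P) (insertions blk π)
All-insertions blk []      pb []         = pb ∷ []
All-insertions blk (v ∷ π) pb (pv ∷ pπ) = AllP.++⁺ pb (pv ∷ pπ) ∷ AllP.map⁺ (All.map (pv ∷_) (All-insertions blk π pb pπ))

∑-insertions-max-maxPair : ∀ f b M π → 0 < b → b < M → All (_< b) π →
  ∑ (λ w → stat f (padded w)) (concatMap (insertions (M ∷ M ∷ [])) (insertions (b ∷ []) π))
  ≡ insertMax (insertMaxPair f) (asc π) (des π) (plat π)
∑-insertions-max-maxPair f b M π 0<b b<M π<b =
  trans (∑-concatMap (λ w → stat f (padded w)) (insertions (M ∷ M ∷ [])) (insertions (b ∷ []) π))
    (trans (∑-cong (insertions (b ∷ []) π)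
             (All.map (λ {w} w<M → ∑-insertions-maxPair f M w (ℕP.<-trans 0<b b<M) w<M)
                      (All-insertions (b ∷ []) π (b<M ∷ []) (All.map (λ c<b → ℕP.<-trans c<b b<M) π<b))))
           (∑-insertions-max (insertMaxPair f) b π 0<b π<b))

∈-insertions⁻ : ∀ blk π {w} → w ∈ insertions blk π → ∃₂ λ u v → π ≡ u ++ v × w ≡ u ++ blk ++ v
∈-insertions⁻ blk []      (here refl) = [] , [] , refl , sym (ListP.++-identityʳ blk)
∈-insertions⁻ blk (c ∷ π) (here refl) = [] , c ∷ π , refl , refl
∈-insertions⁻ blk (c ∷ π) (there p) with ∈-map⁻ (c ∷_) p
... | _ , q , refl with ∈-insertions⁻ blk π q
... | u , v , refl , refl = c ∷ u , v , refl , refl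

∈-insertions⁺ : ∀ blk u v → u ++ blk ++ v ∈ insertions blk (u ++ v)
∈-insertions⁺ blk []      []      = here (ListP.++-identityʳ blk)
∈-insertions⁺ blk []      (c ∷ v) = here refl
∈-insertions⁺ blk (c ∷ u) v       = there (∈-map⁺ (c ∷_) (∈-insertions⁺ blk u v))

Unique-insertions : ∀ h blk π → All (h ≢_) π → Unique (insertions (h ∷ blk) π)
Unique-insertions h blk []      _           = [] ∷ []
Unique-insertions h blk (c ∷ π) (h≢c ∷ h∉π) =
  AllP.map⁺ (All.universal (λ _ eq → h≢c (ListP.∷-injectiveˡ eq)) (insertions (h ∷ blk) π))
  ∷ UniqueP.map⁺ ListP.∷-injectiveʳ (Unique-insertions h blk π h∉π)

Letter : ℕ → ℕ → Set
Letter m c = 1 ≤ c × c ≤ m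

∈-words⁻ : ∀ m L {w} → w ∈ words m L → length w ≡ L × All (Letter m) w
∈-words⁻ m zero    (here refl) = refl , []
∈-words⁻ m (suc L) p with ∈-concatMap⁻′ (λ a → map (a ∷_) (words m L)) {oneTo m} p
... | a , a∈ , q with ∈-map⁻ (a ∷_) q
... | w , w∈ , refl = cong suc (proj₁ (∈-words⁻ m L w∈)) , ∈-oneTo⁻ m a∈ ∷ proj₂ (∈-words⁻ m L w∈)

∈-words⁺ : ∀ m L {w} → length w ≡ L → All (Letter m) w → w ∈ words m L
∈-words⁺ m zero    {[]}    _  _                  = here refl
∈-words⁺ m (suc L) {a ∷ w} eq ((1≤a , a≤m) ∷ ws) =
  ∈-concatMap⁺′ (λ a → map (a ∷_) (words m L)) (∈-oneTo⁺ m 1≤a a≤m) (∈-map⁺ (a ∷_) (∈-words⁺ m L (ℕP.suc-injective eq) ws))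

head₀ : List ℕ → ℕ
head₀ []      = 0
head₀ (a ∷ _) = a

Unique-words : ∀ m L → Unique (words m L)
Unique-words m zero    = [] ∷ []
Unique-words m (suc L) =
  Unique-concatMap (λ a → map (a ∷_) (words m L)) head₀ (Unique-oneTo m)
                   (λ _ → UniqueP.map⁺ ListP.∷-injectiveʳ (Unique-words m L)) head≡
  where
  head≡ : ∀ {a w} → a ∈ oneTo m → w ∈ map (a ∷_) (words m L) → head₀ w ≡ a
  head≡ {a} _ q with ∈-map⁻ (a ∷_) q
  ... | _ , _ , refl = refl

multiplicitiesOK : List ℕ → ℕ → Bool
multiplicitiesOK w k = ⌊ count (barred k) w ℕ.≟ 1 ⌋ ∧ ⌊ count (unbarred k) w ℕ.≟ 2 ⌋

aboveBetween : List ℕ → ℕ → Bool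
aboveBetween w k = allB (λ c → ⌊ unbarred k ℕ.<? c ⌋) (between (unbarred k) w)

JSP-∈⁻ : ∀ m {w} → w ∈ JSP m → w ∈ words (2 ℕ.* m) (3 ℕ.* m) × T (isPermM m w ∧ isJSCond m w)
JSP-∈⁻ m = ∈-filter⁻ (λ w → T? (isPermM m w ∧ isJSCond m w))

JSP-∈⁺ : ∀ m {w} → w ∈ words (2 ℕ.* m) (3 ℕ.* m) → T (isPermM m w ∧ isJSCond m w) → w ∈ JSP m
JSP-∈⁺ m = ∈-filter⁺ (λ w → T? (isPermM m w ∧ isJSCond m w))

JSP-word : ∀ m {w} → w ∈ JSP m → length w ≡ 3 ℕ.* m × All (Letter (2 ℕ.* m)) w
JSP-word m w∈ = ∈-words⁻ (2 ℕ.* m) (3 ℕ.* m) (proj₁ (JSP-∈⁻ m w∈))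

Unique-JSP : ∀ m → Unique (JSP m)
Unique-JSP m = UniqueP.filter⁺ (λ w → T? (isPermM m w ∧ isJSCond m w)) (Unique-words (2 ℕ.* m) (3 ℕ.* m))

-- JSP (n + 1) from JSP n

module Extension (n : ℕ) where

  b M : ℕ
  b = suc (2 ℕ.* n)
  M = suc b

  barred-suc : barred (suc n) ≡ b
  barred-suc = cong (_∸ 1) (ℕP.*-suc 2 n)

  unbarred-suc : unbarred (suc n) ≡ M
  unbarred-suc = ℕP.*-suc 2 n

  Small : ℕ → Set
  Small c = c ≤ 2 ℕ.* n

  small? : U.Decidable Small
  small? c = c ℕ.≤? 2 ℕ.* n

  unbarred-small : ∀ k → k ≤ n → Small (unbarred k)
  unbarred-small k k≤n = ℕP.*-monoʳ-≤ 2 k≤n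

  barred-small : ∀ k → k ≤ n → Small (barred k)
  barred-small k k≤n = ℕP.≤-trans (ℕP.m∸n≤m (2 ℕ.* k) 1) (unbarred-small k k≤n)

  b≢small : ∀ {c} → Small c → b ≢ c
  b≢small c≤2n refl = ℕP.<-irrefl refl c≤2n

  M≢small : ∀ {c} → Small c → M ≢ c
  M≢small c≤2n refl = ℕP.<-irrefl refl (ℕP.m≤n⇒m≤1+n c≤2n)

  M≢b : M ≢ b
  M≢b = ℕP.>⇒≢ (ℕP.n<1+n b)

  extensions : List ℕ → List (List ℕ)
  extensions π = concatMap (insertions (M ∷ M ∷ [])) (insertions (b ∷ []) π)

  count-MM : ∀ a u v → a ≢ M → count a (u ++ M ∷ M ∷ v) ≡ count a (u ++ v)
  count-MM a u v a≢M = begin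
    count a (u ++ M ∷ M ∷ v)           ≡⟨ count-++ a u (M ∷ M ∷ v) ⟩
    count a u ℕ.+ count a (M ∷ M ∷ v)  ≡⟨ cong (count a u ℕ.+_) (trans (count-≢ (M ∷ v) a≢M) (count-≢ v a≢M)) ⟩
    count a u ℕ.+ count a v            ≡⟨ count-++ a u v ⟨
    count a (u ++ v)                   ∎
    where open ≡-Reasoning

  module Decomposed (u₁ v₁ u₂ v₂ : List ℕ) (π-small : All Small (u₁ ++ v₁)) (split : u₂ ++ v₂ ≡ u₁ ++ b ∷ v₁) where

    π w : List ℕ
    π = u₁ ++ v₁
    w = u₂ ++ M ∷ M ∷ v₂

    count-w : ∀ a → a ≢ M → count a w ≡ count a (u₁ ++ b ∷ v₁)
    count-w a a≢M = trans (count-MM a u₂ v₂ a≢M) (cong (count a) split)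

    count-π : ∀ a → a ≢ b → count a (u₁ ++ b ∷ v₁) ≡ count a π
    count-π a a≢b = trans (count-++ a u₁ (b ∷ v₁)) (trans (cong (count a u₁ ℕ.+_) (count-≢ v₁ a≢b)) (sym (count-++ a u₁ v₁)))

    count-b : count b w ≡ 1
    count-b = begin
      count b w                         ≡⟨ count-w b (≢-sym M≢b) ⟩
      count b (u₁ ++ b ∷ v₁)            ≡⟨ trans (count-++ b u₁ (b ∷ v₁)) (cong (count b u₁ ℕ.+_) (count-≡ b v₁)) ⟩
      count b u₁ ℕ.+ suc (count b v₁)   ≡⟨ trans (ℕP.+-suc (count b u₁) (count b v₁)) (cong suc (sym (count-++ b u₁ v₁))) ⟩
      suc (count b π)                   ≡⟨ cong suc (Equivalence.from (count≡0⇔∉ b π) (All.map b≢small π-small)) ⟩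
      1                                 ∎
      where open ≡-Reasoning

    count-M : count M w ≡ 2
    count-M = begin
      count M (u₂ ++ M ∷ M ∷ v₂)              ≡⟨ count-++ M u₂ (M ∷ M ∷ v₂) ⟩
      count M u₂ ℕ.+ count M (M ∷ M ∷ v₂)     ≡⟨ cong (count M u₂ ℕ.+_) (trans (count-≡ M (M ∷ v₂)) (cong suc (count-≡ M v₂))) ⟩
      count M u₂ ℕ.+ suc (suc (count M v₂))   ≡⟨ trans (ℕP.+-suc (count M u₂) _) (cong suc (ℕP.+-suc (count M u₂) _)) ⟩
      2 ℕ.+ (count M u₂ ℕ.+ count M v₂)       ≡⟨ cong (2 ℕ.+_) (sym (count-++ M u₂ v₂)) ⟩
      2 ℕ.+ count M (u₂ ++ v₂)                ≡⟨ cong (λ l → 2 ℕ.+ count M l) split ⟩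
      2 ℕ.+ count M (u₁ ++ b ∷ v₁)            ≡⟨ cong (2 ℕ.+_) (count-π M M≢b) ⟩
      2 ℕ.+ count M π                         ≡⟨ cong (2 ℕ.+_) (Equivalence.from (count≡0⇔∉ M π) (All.map M≢small π-small)) ⟩
      2                                       ∎
      where open ≡-Reasoning

    length-w : length w ≡ 3 ℕ.+ length π
    length-w = begin
      length (u₂ ++ M ∷ M ∷ v₂)          ≡⟨ ListP.length-++ u₂ ⟩
      length u₂ ℕ.+ suc (suc (length v₂)) ≡⟨ trans (ℕP.+-suc (length u₂) _) (cong suc (ℕP.+-suc (length u₂) _)) ⟩
      2 ℕ.+ (length u₂ ℕ.+ length v₂)     ≡⟨ cong (2 ℕ.+_) (sym (ListP.length-++ u₂)) ⟩
      2 ℕ.+ length (u₂ ++ v₂)             ≡⟨ cong (λ l → 2 ℕ.+ length l) split ⟩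
      2 ℕ.+ length (u₁ ++ b ∷ v₁)         ≡⟨ cong (2 ℕ.+_) (ListP.length-++ u₁) ⟩
      2 ℕ.+ (length u₁ ℕ.+ suc (length v₁)) ≡⟨ cong (2 ℕ.+_) (ℕP.+-suc (length u₁) _) ⟩
      3 ℕ.+ (length u₁ ℕ.+ length v₁)     ≡⟨ cong (3 ℕ.+_) (sym (ListP.length-++ u₁)) ⟩
      3 ℕ.+ length π                      ∎
      where open ≡-Reasoning

    filter-w : filter small? w ≡ π
    filter-w = begin
      filter small? (u₂ ++ M ∷ M ∷ v₂)              ≡⟨ ListP.filter-++ small? u₂ (M ∷ M ∷ v₂) ⟩
      filter small? u₂ ++ filter small? (M ∷ M ∷ v₂)
        ≡⟨ cong (filter small? u₂ ++_) (trans (ListP.filter-reject small? M-large) (ListP.filter-reject small? M-large)) ⟩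
      filter small? u₂ ++ filter small? v₂          ≡⟨ ListP.filter-++ small? u₂ v₂ ⟨
      filter small? (u₂ ++ v₂)                      ≡⟨ cong (filter small?) split ⟩
      filter small? (u₁ ++ b ∷ v₁)                  ≡⟨ ListP.filter-++ small? u₁ (b ∷ v₁) ⟩
      filter small? u₁ ++ filter small? (b ∷ v₁)    ≡⟨ cong (filter small? u₁ ++_) (ListP.filter-reject small? b-large) ⟩
      filter small? u₁ ++ filter small? v₁          ≡⟨ ListP.filter-++ small? u₁ v₁ ⟨
      filter small? π                               ≡⟨ ListP.filter-all small? π-small ⟩
      π                                             ∎
      where
      open ≡-Reasoning
      b-large : ¬ Small b
      b-large = ℕP.<-irrefl refl
      M-large : ¬ Small M
      M-large M≤2n = b-large (ℕP.≤-trans (ℕP.n≤1+n b) M≤2n)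

    M∉u₂ : All (M ≢_) u₂
    M∉u₂ = AllP.++⁻ˡ u₂ (subst (All (M ≢_)) (sym split) (AllP.++⁺ (AllP.++⁻ˡ u₁ M∉π) (M≢b ∷ AllP.++⁻ʳ u₁ M∉π)))
      where
      M∉π : All (M ≢_) π
      M∉π = All.map M≢small π-small

    isPermM-w : isPermM (suc n) w ≡ isPermM n π
    isPermM-w = begin
      ⌊ length w ℕ.≟ 3 ℕ.* suc n ⌋ ∧ allB (multiplicitiesOK w) (oneTo (suc n))
        ≡⟨ cong (⌊ length w ℕ.≟ 3 ℕ.* suc n ⌋ ∧_) (allB-oneTo-suc {multiplicitiesOK w} n) ⟩
      ⌊ length w ℕ.≟ 3 ℕ.* suc n ⌋ ∧ (allB (multiplicitiesOK w) (oneTo n) ∧ multiplicitiesOK w (suc n))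
        ≡⟨ cong₂ (λ l m → l ∧ (m ∧ multiplicitiesOK w (suc n))) length-ok (allB-oneTo-cong n same-multiplicities) ⟩
      ⌊ length π ℕ.≟ 3 ℕ.* n ⌋ ∧ (allB (multiplicitiesOK π) (oneTo n) ∧ multiplicitiesOK w (suc n))
        ≡⟨ cong (λ l → ⌊ length π ℕ.≟ 3 ℕ.* n ⌋ ∧ (allB (multiplicitiesOK π) (oneTo n) ∧ l)) new-multiplicities ⟩
      ⌊ length π ℕ.≟ 3 ℕ.* n ⌋ ∧ (allB (multiplicitiesOK π) (oneTo n) ∧ true)
        ≡⟨ cong (⌊ length π ℕ.≟ 3 ℕ.* n ⌋ ∧_) (BoolP.∧-identityʳ _) ⟩
      isPermM n π ∎
      where
      open ≡-Reasoning
      length-ok : ⌊ length w ℕ.≟ 3 ℕ.* suc n ⌋ ≡ ⌊ length π ℕ.≟ 3 ℕ.* n ⌋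
      length-ok = ⌊⌋-⇔ (mk⇔ (λ eq → ℕP.+-cancelˡ-≡ 3 _ _ (trans (sym length-w) (trans eq (ℕP.*-suc 3 n))))
                            (λ eq → trans length-w (trans (cong (3 ℕ.+_) eq) (sym (ℕP.*-suc 3 n)))))
                       (length w ℕ.≟ 3 ℕ.* suc n) (length π ℕ.≟ 3 ℕ.* n)
      count-old : ∀ a → Small a → count a w ≡ count a π
      count-old a a-small = trans (count-w a (≢-sym (M≢small a-small))) (count-π a (≢-sym (b≢small a-small)))
      same-multiplicities : ∀ k → k ≤ n → multiplicitiesOK w k ≡ multiplicitiesOK π k
      same-multiplicities k k≤n =
        cong₂ (λ p q → ⌊ p ℕ.≟ 1 ⌋ ∧ ⌊ q ℕ.≟ 2 ⌋) (count-old (barred k) (barred-small k k≤n)) (count-old (unbarred k) (unbarred-small k k≤n))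
      new-multiplicities : multiplicitiesOK w (suc n) ≡ true
      new-multiplicities rewrite barred-suc | count-b | count-M = refl

    isJSCond-w : isJSCond (suc n) w ≡ isJSCond n π
    isJSCond-w = begin
      allB (aboveBetween w) (oneTo (suc n))                      ≡⟨ allB-oneTo-suc {aboveBetween w} n ⟩
      allB (aboveBetween w) (oneTo n) ∧ aboveBetween w (suc n)  ≡⟨ cong₂ _∧_ (allB-oneTo-cong n same-condition) new-condition ⟩
      allB (aboveBetween π) (oneTo n) ∧ true                     ≡⟨ BoolP.∧-identityʳ _ ⟩
      isJSCond n π                                                ∎
      where
      open ≡-Reasoning
      new-condition : aboveBetween w (suc n) ≡ true
      new-condition rewrite unbarred-suc | between-first M u₂ (M ∷ v₂) M∉u₂ | ⌊⌋-true (M ℕ.≟ M) refl = refl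
      same-condition : ∀ k → k ≤ n → aboveBetween w k ≡ aboveBetween π k
      same-condition k k≤n = sym (begin
        allB (λ c → ⌊ unbarred k ℕ.<? c ⌋) (between (unbarred k) π)
          ≡⟨ cong (λ v → allB (λ c → ⌊ unbarred k ℕ.<? c ⌋) (between (unbarred k) v)) filter-w ⟨
        allB (λ c → ⌊ unbarred k ℕ.<? c ⌋) (between (unbarred k) (filter small? w))
          ≡⟨ cong (allB (λ c → ⌊ unbarred k ℕ.<? c ⌋)) (between-filter small? (unbarred-small k k≤n) w) ⟩
        allB (λ c → ⌊ unbarred k ℕ.<? c ⌋) (filter small? (between (unbarred k) w))
          ≡⟨ allB-filter small? _ (between (unbarred k) w)
               (λ c large → ⌊⌋-true (unbarred k ℕ.<? c) (ℕP.≤-<-trans (unbarred-small k k≤n) (ℕP.≰⇒> large))) ⟩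
        allB (λ c → ⌊ unbarred k ℕ.<? c ⌋) (between (unbarred k) w) ∎)

  Letter-weaken : ∀ {c} → Letter (2 ℕ.* n) c → Letter (2 ℕ.* suc n) c
  Letter-weaken (1≤c , c≤2n) = 1≤c , ℕP.≤-trans c≤2n (ℕP.*-monoʳ-≤ 2 (ℕP.n≤1+n n))

  b-letter : Letter (2 ℕ.* suc n) b
  b-letter = s≤s z≤n , subst (b ≤_) (sym unbarred-suc) (ℕP.n≤1+n b)

  M-letter : Letter (2 ℕ.* suc n) M
  M-letter = s≤s z≤n , ℕP.≤-reflexive (sym unbarred-suc)

  Letters-strengthen : ∀ {cs} → All (Letter (2 ℕ.* suc n)) cs → All (M ≢_) cs → All (b ≢_) cs → All (Letter (2 ℕ.* n)) cs
  Letters-strengthen []                   []          []          = []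
  Letters-strengthen {c ∷ _} ((1≤c , c≤M) ∷ ls) (M≢c ∷ ms) (b≢c ∷ bs) =
    (1≤c , ℕP.≤-pred (ℕP.≤∧≢⇒< (ℕP.≤-pred (ℕP.≤∧≢⇒< (subst (c ≤_) unbarred-suc c≤M) (≢-sym M≢c))) (≢-sym b≢c)))
    ∷ Letters-strengthen ls ms bs

  extension∈JSP : ∀ {π w} → π ∈ JSP n → w ∈ extensions π → w ∈ JSP (suc n)
  extension∈JSP {π} π∈ w∈ with ∈-concatMap⁻′ (insertions (M ∷ M ∷ [])) w∈
  ... | w₁ , w₁∈ , w∈₁ with ∈-insertions⁻ (b ∷ []) π w₁∈
  ... | u₁ , v₁ , refl , refl with ∈-insertions⁻ (M ∷ M ∷ []) (u₁ ++ b ∷ v₁) w∈₁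
  ... | u₂ , v₂ , split , refl =
    JSP-∈⁺ (suc n) (∈-words⁺ (2 ℕ.* suc n) (3 ℕ.* suc n) length-ok letters-ok)
                   (subst T (sym (cong₂ _∧_ isPermM-w isJSCond-w)) (proj₂ (JSP-∈⁻ n π∈)))
    where
    π-word = JSP-word n π∈
    π-letters = proj₂ π-word
    open Decomposed u₁ v₁ u₂ v₂ (All.map proj₂ π-letters) (sym split) using (length-w; isPermM-w; isJSCond-w)
    length-ok : length (u₂ ++ M ∷ M ∷ v₂) ≡ 3 ℕ.* suc n
    length-ok = trans length-w (trans (cong (3 ℕ.+_) (proj₁ π-word)) (sym (ℕP.*-suc 3 n)))
    u₂v₂-letters : All (Letter (2 ℕ.* suc n)) (u₂ ++ v₂)
    u₂v₂-letters = subst (All (Letter (2 ℕ.* suc n))) split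
      (AllP.++⁺ (All.map Letter-weaken (AllP.++⁻ˡ u₁ π-letters)) (b-letter ∷ All.map Letter-weaken (AllP.++⁻ʳ u₁ π-letters)))
    letters-ok : All (Letter (2 ℕ.* suc n)) (u₂ ++ M ∷ M ∷ v₂)
    letters-ok = AllP.++⁺ (AllP.++⁻ˡ u₂ u₂v₂-letters) (M-letter ∷ M-letter ∷ AllP.++⁻ʳ u₂ u₂v₂-letters)

  extensions⊆JSP-suc : ∀ {w} → w ∈ concatMap extensions (JSP n) → w ∈ JSP (suc n)
  extensions⊆JSP-suc w∈ with ∈-concatMap⁻′ extensions w∈
  ... | _ , π∈ , w∈′ = extension∈JSP π∈ w∈′

  module _ {w} (w∈ : w ∈ JSP (suc n)) where

    private
      perm-js = T-∧⁻ (isPermM (suc n) w) (isJSCond (suc n) w) (proj₂ (JSP-∈⁻ (suc n) w∈))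
      last-multiplicities =
        T-∧⁻ ⌊ count (barred (suc n)) w ℕ.≟ 1 ⌋ ⌊ count (unbarred (suc n)) w ℕ.≟ 2 ⌋
          (proj₂ (T-∧⁻ (allB (multiplicitiesOK w) (oneTo n)) (multiplicitiesOK w (suc n))
            (subst T (allB-oneTo-suc {multiplicitiesOK w} n)
              (proj₂ (T-∧⁻ ⌊ length w ℕ.≟ 3 ℕ.* suc n ⌋ (allB (multiplicitiesOK w) (oneTo (suc n))) (proj₁ perm-js))))))

    JSP-suc-count-b : count b w ≡ 1
    JSP-suc-count-b =
      subst (λ a → count a w ≡ 1) barred-suc (toWitness {a? = count (barred (suc n)) w ℕ.≟ 1} (proj₁ last-multiplicities))

    JSP-suc-count-M : count M w ≡ 2
    JSP-suc-count-M =
      subst (λ a → count a w ≡ 2) unbarred-suc (toWitness {a? = count (unbarred (suc n)) w ℕ.≟ 2} (proj₂ last-multiplicities))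

    JSP-suc-between-M : T (allB (λ c → ⌊ M ℕ.<? c ⌋) (between M w))
    JSP-suc-between-M = subst (λ a → T (allB (λ c → ⌊ a ℕ.<? c ⌋) (between a w))) unbarred-suc
                          (proj₂ (T-∧⁻ (allB (aboveBetween w) (oneTo n)) (aboveBetween w (suc n))
                             (subst T (allB-oneTo-suc {aboveBetween w} n) (proj₂ perm-js))))

  -- Nothing fits between the two copies of the largest letter.
  JSP-suc-MM : ∀ {w} → w ∈ JSP (suc n) → ∃₂ λ u v → w ≡ u ++ M ∷ M ∷ v × All (M ≢_) (u ++ v)
  JSP-suc-MM {w} w∈ with split-first M w 1 (JSP-suc-count-M w∈)
  ... | u , c ∷ v , refl , M∉u , count-v with c ℕ.≟ M
  ...   | yes refl =
    u , v , refl , AllP.++⁺ M∉u (Equivalence.to (count≡0⇔∉ M v) (ℕP.suc-injective (trans (sym (count-≡ M v)) count-v)))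
  ...   | no  c≢M  = ⊥-elim (ℕP.<-irrefl refl (ℕP.<-≤-trans M<c c≤M))
    where
    M<c : M < c
    M<c = toWitness {a? = M ℕ.<? c}
            (proj₁ (T-∧⁻ ⌊ M ℕ.<? c ⌋ (allB (λ c → ⌊ M ℕ.<? c ⌋) (takeWhileB (_≢ᵇ M) v))
              (subst (λ l → T (allB (λ c → ⌊ M ℕ.<? c ⌋) l))
                     (trans (between-first M u (c ∷ v) M∉u) (takeWhile-≢ v c≢M)) (JSP-suc-between-M w∈))))
    c≤M : c ≤ M
    c≤M = subst (c ≤_) unbarred-suc
            (proj₂ (All.head (All.tail (AllP.++⁻ʳ u (proj₂ (JSP-word (suc n) w∈))))))

  JSP-suc⊆extensions : ∀ {w} → w ∈ JSP (suc n) → w ∈ concatMap extensions (JSP n)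
  JSP-suc⊆extensions {w} w∈ with JSP-suc-MM w∈
  ... | u₂ , v₂ , refl , M∉u₂v₂
    with split-first b (u₂ ++ v₂) 0 (trans (sym (count-MM b u₂ v₂ (≢-sym M≢b))) (JSP-suc-count-b w∈))
  ... | u₁ , v₁ , split , b∉u₁ , count-v₁ = ∈-concatMap⁺′ extensions π∈ w∈extensions
    where
    w-letters = proj₂ (JSP-word (suc n) w∈)
    letters : All (Letter (2 ℕ.* suc n)) (u₁ ++ b ∷ v₁)
    letters = subst (All _) split (AllP.++⁺ (AllP.++⁻ˡ u₂ w-letters) (All.tail (All.tail (AllP.++⁻ʳ u₂ w-letters))))
    M∉ : All (M ≢_) (u₁ ++ b ∷ v₁)
    M∉ = subst (All _) split M∉u₂v₂
    b∉v₁ : All (b ≢_) v₁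
    b∉v₁ = Equivalence.to (count≡0⇔∉ b v₁) count-v₁
    π-letters : All (Letter (2 ℕ.* n)) (u₁ ++ v₁)
    π-letters = AllP.++⁺ (Letters-strengthen (AllP.++⁻ˡ u₁ letters) (AllP.++⁻ˡ u₁ M∉) b∉u₁)
                         (Letters-strengthen (All.tail (AllP.++⁻ʳ u₁ letters)) (All.tail (AllP.++⁻ʳ u₁ M∉)) b∉v₁)
    open Decomposed u₁ v₁ u₂ v₂ (All.map proj₂ π-letters) split using (length-w; isPermM-w; isJSCond-w)
    π-length : length (u₁ ++ v₁) ≡ 3 ℕ.* n
    π-length = ℕP.+-cancelˡ-≡ 3 _ _ (trans (sym length-w) (trans (proj₁ (JSP-word (suc n) w∈)) (ℕP.*-suc 3 n)))
    π∈ : u₁ ++ v₁ ∈ JSP n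
    π∈ = JSP-∈⁺ n (∈-words⁺ (2 ℕ.* n) (3 ℕ.* n) π-length π-letters)
                  (subst T (cong₂ _∧_ isPermM-w isJSCond-w) (proj₂ (JSP-∈⁻ (suc n) w∈)))
    w∈extensions : u₂ ++ M ∷ M ∷ v₂ ∈ extensions (u₁ ++ v₁)
    w∈extensions = ∈-concatMap⁺′ (insertions (M ∷ M ∷ [])) (∈-insertions⁺ (b ∷ []) u₁ v₁)
                     (subst (λ l → u₂ ++ M ∷ M ∷ v₂ ∈ insertions (M ∷ M ∷ []) l) split (∈-insertions⁺ (M ∷ M ∷ []) u₂ v₂))

  JSP-small : ∀ {π} → π ∈ JSP n → All Small π
  JSP-small π∈ = All.map proj₂ (proj₂ (JSP-word n π∈))

  filter-extension : ∀ {π w} → All Small π → w ∈ extensions π → filter small? w ≡ π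
  filter-extension {π} π-small w∈ with ∈-concatMap⁻′ (insertions (M ∷ M ∷ [])) w∈
  ... | w₁ , w₁∈ , w∈₁ with ∈-insertions⁻ (b ∷ []) π w₁∈
  ... | u₁ , v₁ , refl , refl with ∈-insertions⁻ (M ∷ M ∷ []) (u₁ ++ b ∷ v₁) w∈₁
  ... | u₂ , v₂ , split , refl = Decomposed.filter-w u₁ v₁ u₂ v₂ π-small (sym split)

  Unique-extensions : ∀ {π} → All Small π → Unique (extensions π)
  Unique-extensions {π} π-small =
    Unique-concatMap (insertions (M ∷ M ∷ [])) (filter ≢M?) (Unique-insertions b [] π (All.map b≢small π-small))
      (λ w₁∈ → Unique-insertions M (M ∷ []) _ (M∉ w₁∈)) delete-M
    where
    ≢M? : U.Decidable (_≢ M)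
    ≢M? c = ¬? (c ℕ.≟ M)
    M∉ : ∀ {w₁} → w₁ ∈ insertions (b ∷ []) π → All (M ≢_) w₁
    M∉ w₁∈ with ∈-insertions⁻ (b ∷ []) π w₁∈
    ... | u , v , refl , refl = AllP.++⁺ (AllP.++⁻ˡ u M∉π) (M≢b ∷ AllP.++⁻ʳ u M∉π)
      where
      M∉π = All.map M≢small π-small
    delete-M : ∀ {w₁ w} → w₁ ∈ insertions (b ∷ []) π → w ∈ insertions (M ∷ M ∷ []) w₁ → filter ≢M? w ≡ w₁
    delete-M {w₁} w₁∈ w∈ with ∈-insertions⁻ (M ∷ M ∷ []) w₁ w∈
    ... | u , v , refl , refl = begin
      filter ≢M? (u ++ M ∷ M ∷ v)             ≡⟨ ListP.filter-++ ≢M? u (M ∷ M ∷ v) ⟩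
      filter ≢M? u ++ filter ≢M? (M ∷ M ∷ v)
        ≡⟨ cong (filter ≢M? u ++_) (trans (ListP.filter-reject ≢M? (_$ refl)) (ListP.filter-reject ≢M? (_$ refl))) ⟩
      filter ≢M? u ++ filter ≢M? v            ≡⟨ ListP.filter-++ ≢M? u v ⟨
      filter ≢M? (u ++ v)                     ≡⟨ ListP.filter-all ≢M? (All.map ≢-sym (M∉ w₁∈)) ⟩
      u ++ v                                  ∎
      where open ≡-Reasoning

  Unique-extensions-JSP : Unique (concatMap extensions (JSP n))
  Unique-extensions-JSP =
    Unique-concatMap extensions (filter small?) (Unique-JSP n) (Unique-extensions ∘ JSP-small) (filter-extension ∘ JSP-small)

statSum : ℕ → Weight → ℤ
statSum n f = ∑ (λ π → stat f (padded π)) (JSP n)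

statSum-suc : ∀ n f → statSum (suc n) f ≡ statSum n (insertMax (insertMaxPair f))
statSum-suc n f = begin
    ∑ (λ w → stat f (padded w)) (JSP (suc n))
  ≡⟨ ∑-same-elements _ (Unique-JSP (suc n)) Unique-extensions-JSP JSP-suc⊆extensions extensions⊆JSP-suc ⟩
    ∑ (λ w → stat f (padded w)) (concatMap extensions (JSP n))
  ≡⟨ ∑-concatMap _ extensions (JSP n) ⟩
    ∑ (λ π → ∑ (λ w → stat f (padded w)) (extensions π)) (JSP n)
  ≡⟨ ∑-cong (JSP n) (All.tabulate λ π∈ →
       ∑-insertions-max-maxPair f b M _ (s≤s z≤n) (ℕP.n<1+n b) (All.map s≤s (JSP-small π∈))) ⟩
    statSum n (insertMax (insertMaxPair f))
  ∎
  where
  open ≡-Reasoning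
  open Extension n

statSum≡evalTerms : ∀ n f → statSum n f ≡ evalTerms f (expansion n)
statSum≡evalTerms zero    f = cong (_+ + 0) (sym (ℤP.*-identityˡ (f 0 0 1)))
statSum≡evalTerms (suc n) f =
  trans (statSum-suc n f) (trans (statSum≡evalTerms n (insertMax (insertMaxPair f))) (evalTerms-expansion-suc f n))

theorem14 : (n : ℕ) → n ≥ 1 → (x y z : ℤ) → S n x y z ≡ RHS n x y z
theorem14 (suc n) _ x y z = trans (statSum≡evalTerms (suc n) (monomial x y z)) (sym (RHS≡evalTerms n x y z))
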